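{- Consider the online game of arbitrary length $T$ (fixed in advance, unknown to the player): vectors $v_1,\ldots,v_T$ are independent and uniform on $\{ -1,+1\}^n$ and signs $x_t\in\{ -1,+1\}$ are chosen by the majority rule described in the context. Let $V(n,T)=\left|\sum_{t=1}^T x_tv_t\right|_\infty$. Then $\mathbb{E}[V(n,T)] = O(\sqrt{n}\ln n)$ (with an absolute implied constant, independent of $T$). More precisely, there is an absolute constant $a>0$ such that for all $k>0$ the probability that some coordinate $i$ has $|P_T(i)|\ge k\sqrt n$ is at most $n e^{ -ak}$ (up to an absolute constant factor).
   Context: Let $P_t=\sum_{s=1}^t x_sv_s$ with $P_0=0$, and $P_t(i)$ its $i$-th coordinate. Majority rule: at round $t$, let $N_+=\#\{i: P_{t-1}(i)\ne0,\ v_t(i)P_{t-1}(i)>0\}$ and $N_-=\#\{i: P_{t-1}(i)\ne0,\ v_t(i)P_{t-1}(i)<0\}$. If $N_+>N_-$ choose $x_t=-1$, if $N_->N_+$ choose $x_t=+1$ (in either case the strict majority of the nonzero coordinates move toward zero in absolute value), and if $N_+=N_-$ choose $x_t$ uniformly at random, independently of everything else. -}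

module Defs where

open import Data.Bool using (Bool; true; false; if_then_else_; _∨_)
open import Data.Nat using (ℕ; zero; suc; _+_; _*_; _^_; _⊔_; _<ᵇ_; _≤ᵇ_)
open import Data.Integer using (ℤ; +_; -[1+_]; +[1+_]; ∣_∣) renaming (_+_ to _+ℤ_; _*_ to _*ℤ_)
open import Data.List using (List; []; _∷_; map; concatMap)
open import Data.Nat.ListAction using () renaming (sum to sumL)
open import Data.Vec using (Vec; []; _∷_; zipWith; foldr′)
import Data.Vec as V
open import Data.Product using (_×_; _,_)

-- A sign in {-1,+1}, encoded by a Bool (true = +1, false = -1).
sgn : Bool → ℤ
sgn true  = + 1
sgn false = -[1+ 0 ]

agrees : ℤ → Bool → Bool
agrees +[1+ _ ] true  = true
agrees -[1+ _ ] false = true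
agrees _        _     = false

disagrees : ℤ → Bool → Bool
disagrees +[1+ _ ] false = true
disagrees -[1+ _ ] true  = true
disagrees _        _     = false

b2n : Bool → ℕ
b2n true  = 1
b2n false = 0

Nplus : ∀ {n} → Vec ℤ n → Vec Bool n → ℕ
Nplus P v = V.sum (zipWith (λ p b → b2n (agrees p b)) P v)

Nminus : ∀ {n} → Vec ℤ n → Vec Bool n → ℕ
Nminus P v = V.sum (zipWith (λ p b → b2n (disagrees p b)) P v)

-- Majority rule; the Bool c is the independent fair coin used only on ties.
chooseX : ∀ {n} → Vec ℤ n → Vec Bool n → Bool → ℤ
chooseX P v c =
  if Nminus P v <ᵇ Nplus P v then -[1+ 0 ]
  else (if Nplus P v <ᵇ Nminus P v then + 1 else sgn c)

step : ∀ {n} → Vec ℤ n → Vec Bool n × Bool → Vec ℤ n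
step P (v , c) = zipWith (λ p b → p +ℤ (chooseX P v c *ℤ sgn b)) P v

run : ∀ {n} → Vec ℤ n → List (Vec Bool n × Bool) → Vec ℤ n
run P []       = P
run P (r ∷ rs) = run (step P r) rs

finalP : ∀ n → List (Vec Bool n × Bool) → Vec ℤ n
finalP n rs = run (V.replicate n (+ 0)) rs

Vinf : ∀ n → List (Vec Bool n × Bool) → ℕ
Vinf n rs = foldr′ (λ p m → ∣ p ∣ ⊔ m) 0 (finalP n rs)

allVecs : ∀ n → List (Vec Bool n)
allVecs zero    = [] ∷ []
allVecs (suc n) = concatMap (λ b → map (b ∷_) (allVecs n)) (true ∷ false ∷ [])

allRounds : ∀ n → List (Vec Bool n × Bool)
allRounds n = concatMap (λ v → map (v ,_) (true ∷ false ∷ [])) (allVecs n)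

-- All 2^((n+1)T) equally likely outcomes of a game of length T
-- (uniform v_1..v_T and independent tie-breaking coins).
outcomes : ∀ n → ℕ → List (List (Vec Bool n × Bool))
outcomes n zero    = [] ∷ []
outcomes n (suc T) = concatMap (λ r → map (r ∷_) (outcomes n T)) (allRounds n)

Ω : ℕ → ℕ → ℕ
Ω n T = 2 ^ ((n + 1) * T)

-- Sum of V(n,T) over all outcomes (= Ω n T * E[V(n,T)]).
sumV : ℕ → ℕ → ℕ
sumV n T = sumL (map (Vinf n) (outcomes n T))

-- some coordinate i has |P_T(i)| ≥ k √n, i.e. |P_T(i)|² ≥ k² n (k ∈ ℕ)
someBig : ∀ n → ℕ → List (Vec Bool n × Bool) → Bool
someBig n k rs = foldr′ (λ p acc → (k * k * n ≤ᵇ ∣ p ∣ * ∣ p ∣) ∨ acc) false (finalP n rs)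

countBig : ℕ → ℕ → ℕ → ℕ
countBig n T k = sumL (map (λ rs → b2n (someBig n k rs)) (outcomes n T))

-- Fix a coordinate i and the potential ρ ^ |P_t(i)| with ρ = 1 + 1/s and s ≈ √(8n). When P_t(i) ≠ 0
-- the majority rule moves it towards 0 unless the other coordinates outvote it, and counting ±1-walks
-- through the central binomial coefficient shows that coordinate i is pivotal for at least a 1/s fraction
-- of the vectors v_t. So the expected potential contracts by the factor 1 - 1/(2s²) up to an additive
-- 1/s + 1/(2s²), and it stays below 2s + 2 for every T. Markov's inequality then gives
-- P(|P_T(i)| ≥ s j) ≤ (2s + 2) 2^-j; a union bound over the n coordinates yields the tail estimate, and
-- summing these tails over j ≥ 2 log₂ n + 11 bounds E[V(n,T)] by O(√n log n).

module Submission where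

open import Defs
open import Data.Bool using (Bool; true; false; if_then_else_; _∨_; T)
open import Data.Empty using (⊥-elim)
open import Data.Fin using (Fin; zero; suc)
open import Data.Integer as ℤ using (ℤ; +_; -[1+_]; +[1+_]; ∣_∣)
import Data.Integer.Properties as ℤP
import Data.Integer.Solver as ℤ-Solver
open import Data.List using (List; []; _∷_; map; concatMap; _++_; length)
open import Data.List.Properties using (map-++; map-∘; map-cong; length-map; length-++)
open import Data.Nat
open import Data.Nat.DivMod using (_/_; _%_; m≡m%n+[m/n]*n; m/n*n≤m; m%n<n)
open import Data.Nat.ListAction using () renaming (sum to sumL)
open import Data.Nat.ListAction.Properties using (sum-++)
open import Data.Nat.Logarithm using (⌊log₂_⌋; ⌊log₂⌋-mono-≤; ⌊log₂[2^n]⌋≡n)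
open import Data.Nat.Properties
import Data.Nat.Solver as ℕ-Solver
open import Data.Product using (Σ-syntax; _×_; _,_)
open import Data.Rational as ℚ using (ℚ; 0ℚ; 1ℚ)
import Data.Rational.Properties as ℚP
import Data.Rational.Solver as ℚ-Solver
open import Data.Sum using (_⊎_; inj₁; inj₂)
open import Data.Unit using (tt)
open import Data.Vec as V using (Vec; []; _∷_; lookup; removeAt; foldr′)
import Data.Vec.Properties as VP
open import Function using (_∘_)
open import Relation.Binary.PropositionalEquality
open import Relation.Nullary using (yes; no)
open import Relation.Nullary.Decidable using (toWitness)

toℚ : ℕ → ℚ
toℚ zero    = 0ℚ
toℚ (suc n) = 1ℚ ℚ.+ toℚ n

toℚ-+ : ∀ m n → toℚ (m + n) ≡ toℚ m ℚ.+ toℚ n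
toℚ-+ zero    n = sym (ℚP.+-identityˡ (toℚ n))
toℚ-+ (suc m) n = trans (cong (1ℚ ℚ.+_) (toℚ-+ m n)) (sym (ℚP.+-assoc 1ℚ (toℚ m) (toℚ n)))

toℚ-* : ∀ m n → toℚ (m * n) ≡ toℚ m ℚ.* toℚ n
toℚ-* zero    n = sym (ℚP.*-zeroˡ (toℚ n))
toℚ-* (suc m) n = begin
  toℚ (n + m * n)               ≡⟨ toℚ-+ n (m * n) ⟩
  toℚ n ℚ.+ toℚ (m * n)         ≡⟨ cong (toℚ n ℚ.+_) (toℚ-* m n) ⟩
  toℚ n ℚ.+ toℚ m ℚ.* toℚ n     ≡⟨ solve 2 (λ a b → b :+ a :* b := (con 1ℚ :+ a) :* b) refl (toℚ m) (toℚ n) ⟩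
  (1ℚ ℚ.+ toℚ m) ℚ.* toℚ n      ∎
  where
  open ≡-Reasoning
  open ℚ-Solver.+-*-Solver

0≤toℚ : ∀ n → 0ℚ ℚ.≤ toℚ n
0≤toℚ zero    = ℚP.≤-refl
0≤toℚ (suc n) = ℚP.+-mono-≤ (ℚP.<⇒≤ (ℚP.positive⁻¹ 1ℚ)) (0≤toℚ n)

toℚ-mono-< : ∀ {m n} → m < n → toℚ m ℚ.< toℚ n
toℚ-mono-< {zero}  {suc n} _ = ℚP.<-≤-trans (ℚP.positive⁻¹ 1ℚ)
  (ℚP.≤-trans (ℚP.≤-reflexive (sym (ℚP.+-identityʳ 1ℚ))) (ℚP.+-monoʳ-≤ 1ℚ (0≤toℚ n)))
toℚ-mono-< {suc m} {suc n} (s≤s m<n) = ℚP.+-monoʳ-< 1ℚ (toℚ-mono-< m<n)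

toℚ-mono-≤ : ∀ {m n} → m ≤ n → toℚ m ℚ.≤ toℚ n
toℚ-mono-≤ {zero}  {n}     _         = 0≤toℚ n
toℚ-mono-≤ {suc m} {suc n} (s≤s m≤n) = ℚP.+-monoʳ-≤ 1ℚ (toℚ-mono-≤ m≤n)

toℚ-cancel-≤ : ∀ {m n} → toℚ m ℚ.≤ toℚ n → m ≤ n
toℚ-cancel-≤ {m} {n} h with m ≤? n
... | yes m≤n = m≤n
... | no  m≰n = ⊥-elim (ℚP.<-irrefl refl (ℚP.<-≤-trans (toℚ-mono-< (≰⇒> m≰n)) h))

∑ : ∀ {A : Set} → List A → (A → ℚ) → ℚ
∑ []       f = 0ℚ
∑ (x ∷ xs) f = f x ℚ.+ ∑ xs f

syntax ∑ xs (λ x → e) = ∑[ x ∈ xs ] e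

module _ {A : Set} where

  ∑-++ : ∀ (f : A → ℚ) xs ys → ∑ (xs ++ ys) f ≡ ∑ xs f ℚ.+ ∑ ys f
  ∑-++ f []       ys = sym (ℚP.+-identityˡ _)
  ∑-++ f (x ∷ xs) ys = trans (cong (f x ℚ.+_) (∑-++ f xs ys)) (sym (ℚP.+-assoc (f x) _ _))

  ∑-cong : ∀ {f g : A → ℚ} → (∀ x → f x ≡ g x) → ∀ xs → ∑ xs f ≡ ∑ xs g
  ∑-cong f≗g []       = refl
  ∑-cong f≗g (x ∷ xs) = cong₂ ℚ._+_ (f≗g x) (∑-cong f≗g xs)

  ∑-mono-≤ : ∀ {f g : A → ℚ} → (∀ x → f x ℚ.≤ g x) → ∀ xs → ∑ xs f ℚ.≤ ∑ xs g
  ∑-mono-≤ f≤g []       = ℚP.≤-refl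
  ∑-mono-≤ f≤g (x ∷ xs) = ℚP.+-mono-≤ (f≤g x) (∑-mono-≤ f≤g xs)

  ∑-+ : ∀ (f g : A → ℚ) xs → ∑[ x ∈ xs ] (f x ℚ.+ g x) ≡ ∑ xs f ℚ.+ ∑ xs g
  ∑-+ f g []       = refl
  ∑-+ f g (x ∷ xs) = begin
    f x ℚ.+ g x ℚ.+ ∑[ x ∈ xs ] (f x ℚ.+ g x)  ≡⟨ cong (f x ℚ.+ g x ℚ.+_) (∑-+ f g xs) ⟩
    f x ℚ.+ g x ℚ.+ (∑ xs f ℚ.+ ∑ xs g)        ≡⟨ solve 4 (λ a b c d → a :+ b :+ (c :+ d) := a :+ c :+ (b :+ d)) refl (f x) (g x) (∑ xs f) (∑ xs g) ⟩
    f x ℚ.+ ∑ xs f ℚ.+ (g x ℚ.+ ∑ xs g)        ∎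
    where
    open ≡-Reasoning
    open ℚ-Solver.+-*-Solver

  ∑-*ˡ : ∀ c (f : A → ℚ) xs → ∑[ x ∈ xs ] (c ℚ.* f x) ≡ c ℚ.* ∑ xs f
  ∑-*ˡ c f []       = sym (ℚP.*-zeroʳ c)
  ∑-*ˡ c f (x ∷ xs) = trans (cong (c ℚ.* f x ℚ.+_) (∑-*ˡ c f xs)) (sym (ℚP.*-distribˡ-+ c _ _))

  ∑-const : ∀ c (xs : List A) → ∑[ x ∈ xs ] c ≡ toℚ (length xs) ℚ.* c
  ∑-const c []       = sym (ℚP.*-zeroˡ c)
  ∑-const c (x ∷ xs) = trans (cong (c ℚ.+_) (∑-const c xs)) (solve 2 (λ l c → c :+ l :* c := (con 1ℚ :+ l) :* c) refl (toℚ (length xs)) c)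
    where open ℚ-Solver.+-*-Solver

  ∑-toℚ : ∀ (f : A → ℕ) xs → ∑[ x ∈ xs ] toℚ (f x) ≡ toℚ (sumL (map f xs))
  ∑-toℚ f []       = refl
  ∑-toℚ f (x ∷ xs) = trans (cong (toℚ (f x) ℚ.+_) (∑-toℚ f xs)) (sym (toℚ-+ (f x) _))

  ∑-affine : ∀ a w (f : A → ℚ) xs →
             ∑[ x ∈ xs ] (a ℚ.- f x ℚ.* w) ≡ toℚ (length xs) ℚ.* a ℚ.- ∑ xs f ℚ.* w
  ∑-affine a w f []       = solve 2 (λ a w → con 0ℚ := con 0ℚ :* a :- con 0ℚ :* w) refl a w
    where open ℚ-Solver.+-*-Solver
  ∑-affine a w f (x ∷ xs) rewrite ∑-affine a w f xs =
    solve 5 (λ a w y l σ → (a :- y :* w) :+ (l :* a :- σ :* w) := (con 1ℚ :+ l) :* a :- (y :+ σ) :* w)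
          refl a w (f x) (toℚ (length xs)) (∑ xs f)
    where open ℚ-Solver.+-*-Solver

∑-map : ∀ {A B : Set} (f : B → ℚ) (g : A → B) xs → ∑ (map g xs) f ≡ ∑ xs (f ∘ g)
∑-map f g []       = refl
∑-map f g (x ∷ xs) = cong (f (g x) ℚ.+_) (∑-map f g xs)

∑-concatMap : ∀ {A B : Set} (f : B → ℚ) (g : A → List B) xs →
              ∑ (concatMap g xs) f ≡ ∑[ x ∈ xs ] ∑ (g x) f
∑-concatMap f g []       = refl
∑-concatMap f g (x ∷ xs) = trans (∑-++ f (g x) _) (cong (∑ (g x) f ℚ.+_) (∑-concatMap f g xs))

*-monoˡ-≤-0≤ : ∀ {r p q} → 0ℚ ℚ.≤ r → p ℚ.≤ q → r ℚ.* p ℚ.≤ r ℚ.* q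
*-monoˡ-≤-0≤ {r} 0≤r p≤q = ℚP.*-monoˡ-≤-nonNeg r {{ℚ.nonNegative 0≤r}} p≤q

0≤* : ∀ {p q} → 0ℚ ℚ.≤ p → 0ℚ ℚ.≤ q → 0ℚ ℚ.≤ p ℚ.* q
0≤* {p} 0≤p 0≤q = ℚP.≤-trans (ℚP.≤-reflexive (sym (ℚP.*-zeroʳ p))) (*-monoˡ-≤-0≤ 0≤p 0≤q)

p≤p+q : ∀ x {y} → 0ℚ ℚ.≤ y → x ℚ.≤ x ℚ.+ y
p≤p+q x 0≤y = ℚP.≤-trans (ℚP.≤-reflexive (sym (ℚP.+-identityʳ x))) (ℚP.+-monoʳ-≤ x 0≤y)

p≤q⇒0≤q-p : ∀ {x y} → x ℚ.≤ y → 0ℚ ℚ.≤ y ℚ.- x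
p≤q⇒0≤q-p {x} {y} x≤y = ℚP.≤-trans (ℚP.≤-reflexive (sym (ℚP.+-inverseʳ x))) (ℚP.+-monoˡ-≤ (ℚ.- x) x≤y)

-- The game as a sum over all outcomes

length-concatMap-map : ∀ {A B C : Set} (h : A → B → C) xs (ys : List B) →
                       length (concatMap (λ x → map (h x) ys) xs) ≡ length xs * length ys
length-concatMap-map h []       ys = refl
length-concatMap-map h (x ∷ xs) ys =
  trans (length-++ (map (h x) ys)) (cong₂ _+_ (length-map (h x) ys) (length-concatMap-map h xs ys))

length-allVecs : ∀ n → length (allVecs n) ≡ 2 ^ n
length-allVecs zero    = refl
length-allVecs (suc n) =
  trans (length-concatMap-map (λ b → b ∷_) (true ∷ false ∷ []) (allVecs n)) (cong (2 *_) (length-allVecs n))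

length-allRounds : ∀ n → length (allRounds n) ≡ 2 * 2 ^ n
length-allRounds n = trans (length-concatMap-map _,_ (allVecs n) (true ∷ false ∷ []))
  (trans (cong (_* 2) (length-allVecs n)) (*-comm (2 ^ n) 2))

length-outcomes-suc : ∀ n T → length (outcomes n (suc T)) ≡ length (allRounds n) * length (outcomes n T)
length-outcomes-suc n T = length-concatMap-map _∷_ (allRounds n) (outcomes n T)

length-outcomes : ∀ n T → length (outcomes n T) ≡ Ω n T
length-outcomes n zero    = cong (2 ^_) (sym (*-zeroʳ (n + 1)))
length-outcomes n (suc T) = begin
  length (outcomes n (suc T))        ≡⟨ length-outcomes-suc n T ⟩
  length (allRounds n) * length (outcomes n T)
                                     ≡⟨ cong₂ _*_ (length-allRounds n) (length-outcomes n T) ⟩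
  2 * 2 ^ n * 2 ^ ((n + 1) * T)      ≡⟨ sym (^-distribˡ-+-* 2 (suc n) ((n + 1) * T)) ⟩
  2 ^ (1 + n + (n + 1) * T)          ≡⟨ cong (λ m → 2 ^ (m + (n + 1) * T)) (+-comm 1 n) ⟩
  2 ^ (n + 1 + (n + 1) * T)          ≡⟨ cong (2 ^_) (sym (*-suc (n + 1) T)) ⟩
  Ω n (suc T)                        ∎
  where open ≡-Reasoning

runTotal : ∀ {n} → ℕ → (Vec ℤ n → ℚ) → Vec ℤ n → ℚ
runTotal {n} T f P = ∑[ rs ∈ outcomes n T ] f (run P rs)

stepTotal : ∀ {n} → (Vec ℤ n → ℚ) → Vec ℤ n → ℚ
stepTotal {n} f P = ∑[ r ∈ allRounds n ] f (step P r)

runTotal-zero : ∀ {n} f (P : Vec ℤ n) → runTotal 0 f P ≡ f P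
runTotal-zero f P = ℚP.+-identityʳ (f P)

runTotal-suc-first : ∀ {n} T f (P : Vec ℤ n) →
                     runTotal (suc T) f P ≡ ∑[ r ∈ allRounds n ] runTotal T f (step P r)
runTotal-suc-first {n} T f P =
  trans (∑-concatMap (λ rs → f (run P rs)) (λ r → map (r ∷_) (outcomes n T)) (allRounds n))
        (∑-cong (λ r → ∑-map (λ rs → f (run P rs)) (r ∷_) (outcomes n T)) (allRounds n))

runTotal-suc : ∀ {n} T f (P : Vec ℤ n) → runTotal (suc T) f P ≡ runTotal T (stepTotal f) P
runTotal-suc {n} zero    f P = begin
  runTotal 1 f P                               ≡⟨ runTotal-suc-first 0 f P ⟩
  ∑[ r ∈ allRounds n ] runTotal 0 f (step P r) ≡⟨ ∑-cong (λ r → runTotal-zero f (step P r)) (allRounds n) ⟩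
  stepTotal f P                                ≡⟨ runTotal-zero (stepTotal f) P ⟨
  runTotal 0 (stepTotal f) P                   ∎
  where open ≡-Reasoning
runTotal-suc {n} (suc T) f P = begin
  runTotal (suc (suc T)) f P                        ≡⟨ runTotal-suc-first (suc T) f P ⟩
  ∑[ r ∈ allRounds n ] runTotal (suc T) f (step P r) ≡⟨ ∑-cong (λ r → runTotal-suc T f (step P r)) (allRounds n) ⟩
  ∑[ r ∈ allRounds n ] runTotal T (stepTotal f) (step P r) ≡⟨ runTotal-suc-first T (stepTotal f) P ⟨
  runTotal (suc T) (stepTotal f) P                  ∎
  where open ≡-Reasoning

runTotal-mono-≤ : ∀ {n} T {f g : Vec ℤ n → ℚ} → (∀ Q → f Q ℚ.≤ g Q) → ∀ P → runTotal T f P ℚ.≤ runTotal T g P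
runTotal-mono-≤ {n} T f≤g P = ∑-mono-≤ (λ rs → f≤g (run P rs)) (outcomes n T)

runTotal-affine : ∀ {n} T a b (f : Vec ℤ n → ℚ) P →
  runTotal T (λ Q → a ℚ.* f Q ℚ.+ b) P ≡ a ℚ.* runTotal T f P ℚ.+ toℚ (length (outcomes n T)) ℚ.* b
runTotal-affine {n} T a b f P =
  trans (∑-+ (λ rs → a ℚ.* f (run P rs)) (λ _ → b) (outcomes n T))
        (cong₂ ℚ._+_ (∑-*ˡ a (λ rs → f (run P rs)) (outcomes n T)) (∑-const b (outcomes n T)))

drift-fixpoint : ∀ {γ β X} → β ℚ.≤ γ ℚ.* X → (1ℚ ℚ.- γ) ℚ.* X ℚ.+ β ℚ.≤ X
drift-fixpoint {γ} {β} {X} β≤γX = begin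
  (1ℚ ℚ.- γ) ℚ.* X ℚ.+ β          ≤⟨ ℚP.+-monoʳ-≤ ((1ℚ ℚ.- γ) ℚ.* X) β≤γX ⟩
  (1ℚ ℚ.- γ) ℚ.* X ℚ.+ γ ℚ.* X    ≡⟨ solve 2 (λ u x → (con 1ℚ :- u) :* x :+ u :* x := x) refl γ X ⟩
  X                               ∎
  where
  open ℚP.≤-Reasoning
  open ℚ-Solver.+-*-Solver

-- A supermartingale bound: g decays by the factor 1 - γ up to an additive β per round,
-- so its expectation never exceeds its initial value plus the equilibrium level c ≥ β / γ.
runTotal-≤-of-drift : ∀ {n} (g : Vec ℤ n → ℚ) {γ β c} →
  (∀ Q → 0ℚ ℚ.≤ g Q) → 0ℚ ℚ.≤ γ → 0ℚ ℚ.≤ 1ℚ ℚ.- γ → 0ℚ ℚ.≤ c → β ℚ.≤ γ ℚ.* c →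
  (∀ Q → stepTotal g Q ℚ.≤ toℚ (length (allRounds n)) ℚ.* ((1ℚ ℚ.- γ) ℚ.* g Q ℚ.+ β)) →
  ∀ T P → runTotal T g P ℚ.≤ toℚ (length (outcomes n T)) ℚ.* (g P ℚ.+ c)
runTotal-≤-of-drift g {γ} {β} {c} 0≤g 0≤γ 0≤1-γ 0≤c β≤γc drift zero P = begin
  runTotal 0 g P          ≡⟨ runTotal-zero g P ⟩
  g P                     ≤⟨ p≤p+q (g P) 0≤c ⟩
  g P ℚ.+ c               ≡⟨ ℚP.*-identityˡ (g P ℚ.+ c) ⟨
  1ℚ ℚ.* (g P ℚ.+ c)      ≡⟨ cong (ℚ._* (g P ℚ.+ c)) (ℚP.+-identityʳ 1ℚ) ⟨
  toℚ 1 ℚ.* (g P ℚ.+ c)   ∎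
  where open ℚP.≤-Reasoning
runTotal-≤-of-drift {n} g {γ} {β} {c} 0≤g 0≤γ 0≤1-γ 0≤c β≤γc drift (suc T) P = begin
  runTotal (suc T) g P                                     ≡⟨ runTotal-suc T g P ⟩
  runTotal T (stepTotal g) P                               ≤⟨ runTotal-mono-≤ T drift′ P ⟩
  runTotal T (λ Q → (N ℚ.* (1ℚ ℚ.- γ)) ℚ.* g Q ℚ.+ N ℚ.* β) P
                                                           ≡⟨ runTotal-affine T (N ℚ.* (1ℚ ℚ.- γ)) (N ℚ.* β) g P ⟩
  (N ℚ.* (1ℚ ℚ.- γ)) ℚ.* runTotal T g P ℚ.+ L ℚ.* (N ℚ.* β)
    ≤⟨ ℚP.+-monoˡ-≤ (L ℚ.* (N ℚ.* β)) (*-monoˡ-≤-0≤ (0≤* (0≤toℚ #R) 0≤1-γ) (runTotal-≤-of-drift g 0≤g 0≤γ 0≤1-γ 0≤c β≤γc drift T P)) ⟩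
  (N ℚ.* (1ℚ ℚ.- γ)) ℚ.* (L ℚ.* X) ℚ.+ L ℚ.* (N ℚ.* β)
    ≡⟨ solve 5 (λ a b u x y → (a :* u) :* (b :* x) :+ b :* (a :* y) := (a :* b) :* (u :* x :+ y)) refl N L (1ℚ ℚ.- γ) X β ⟩
  (N ℚ.* L) ℚ.* ((1ℚ ℚ.- γ) ℚ.* X ℚ.+ β)                   ≤⟨ *-monoˡ-≤-0≤ (0≤* (0≤toℚ #R) (0≤toℚ #O)) (drift-fixpoint {γ} β≤γX) ⟩
  (N ℚ.* L) ℚ.* X                                          ≡⟨ cong (ℚ._* X) (toℚ-* #R #O) ⟨
  toℚ (#R * #O) ℚ.* X                                       ≡⟨ cong (λ m → toℚ m ℚ.* X) (length-outcomes-suc n T) ⟨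
  toℚ (length (outcomes n (suc T))) ℚ.* X                  ∎
  where
  open ℚP.≤-Reasoning
  open ℚ-Solver.+-*-Solver
  #R = length (allRounds n)
  #O = length (outcomes n T)
  N = toℚ #R
  L = toℚ #O
  X = g P ℚ.+ c
  drift′ : ∀ Q → stepTotal g Q ℚ.≤ (N ℚ.* (1ℚ ℚ.- γ)) ℚ.* g Q ℚ.+ N ℚ.* β
  drift′ Q = ℚP.≤-trans (drift Q) (ℚP.≤-reflexive
    (solve 4 (λ a x y b → a :* (x :* y :+ b) := (a :* x) :* y :+ a :* b) refl N (1ℚ ℚ.- γ) (g Q) β))
  β≤γX : β ℚ.≤ γ ℚ.* X
  β≤γX = ℚP.≤-trans β≤γc (*-monoˡ-≤-0≤ 0≤γ (ℚP.≤-trans (ℚP.≤-reflexive (sym (ℚP.+-identityˡ c))) (ℚP.+-monoˡ-≤ c (0≤g P))))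

-- Agreement with the majority and pivotal coordinates

agreement : ℤ → Bool → ℤ
agreement +[1+ _ ] true  = + 1
agreement +[1+ _ ] false = -[1+ 0 ]
agreement -[1+ _ ] true  = -[1+ 0 ]
agreement -[1+ _ ] false = + 1
agreement (+ 0)    _     = + 0

agrees-disagrees : ∀ p b → + b2n (agrees p b) ℤ.- + b2n (disagrees p b) ≡ agreement p b
agrees-disagrees +[1+ _ ] true  = refl
agrees-disagrees +[1+ _ ] false = refl
agrees-disagrees -[1+ _ ] true  = refl
agrees-disagrees -[1+ _ ] false = refl
agrees-disagrees (+ 0)    true  = refl
agrees-disagrees (+ 0)    false = refl

totalAgreement : ∀ {n} → Vec ℤ n → Vec Bool n → ℤ
totalAgreement []      []      = + 0
totalAgreement (p ∷ P) (b ∷ v) = agreement p b ℤ.+ totalAgreement P v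

Nplus-Nminus : ∀ {n} (P : Vec ℤ n) v → + Nplus P v ℤ.- + Nminus P v ≡ totalAgreement P v
Nplus-Nminus []      []      = refl
Nplus-Nminus (p ∷ P) (b ∷ v) = begin
  + (a + α) ℤ.- + (d + δ)             ≡⟨ cong₂ ℤ._-_ (ℤP.pos-+ a α) (ℤP.pos-+ d δ) ⟩
  (+ a ℤ.+ + α) ℤ.- (+ d ℤ.+ + δ)     ≡⟨ solve 4 (λ x y z w → (x :+ y) :- (z :+ w) := (x :- z) :+ (y :- w)) refl (+ a) (+ α) (+ d) (+ δ) ⟩
  (+ a ℤ.- + d) ℤ.+ (+ α ℤ.- + δ)     ≡⟨ cong₂ ℤ._+_ (agrees-disagrees p b) (Nplus-Nminus P v) ⟩
  agreement p b ℤ.+ totalAgreement P v ∎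
  where
  open ≡-Reasoning
  open ℤ-Solver.+-*-Solver
  a = b2n (agrees p b)
  d = b2n (disagrees p b)
  α = Nplus P v
  δ = Nminus P v

totalAgreement-removeAt : ∀ {n} (P : Vec ℤ (suc n)) v i →
  totalAgreement P v ≡ agreement (lookup P i) (lookup v i) ℤ.+ totalAgreement (removeAt P i) (removeAt v i)
totalAgreement-removeAt (p ∷ P)      (b ∷ v)      zero    = refl
totalAgreement-removeAt (p ∷ q ∷ P) (b ∷ c ∷ v) (suc i) = begin
  agreement p b ℤ.+ totalAgreement (q ∷ P) (c ∷ v) ≡⟨ cong (ℤ._+_ (agreement p b)) (totalAgreement-removeAt (q ∷ P) (c ∷ v) i) ⟩
  agreement p b ℤ.+ (x ℤ.+ y)                       ≡⟨ solve 3 (λ a c d → a :+ (c :+ d) := c :+ (a :+ d)) refl (agreement p b) x y ⟩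
  x ℤ.+ (agreement p b ℤ.+ y)                       ∎
  where
  open ≡-Reasoning
  open ℤ-Solver.+-*-Solver
  x = agreement (lookup (q ∷ P) i) (lookup (c ∷ v) i)
  y = totalAgreement (removeAt (q ∷ P) i) (removeAt (c ∷ v) i)

∑-allVecs-suc : ∀ n (F : Vec Bool (suc n) → ℚ) →
  ∑ (allVecs (suc n)) F ≡ ∑[ w ∈ allVecs n ] F (true ∷ w) ℚ.+ (∑[ w ∈ allVecs n ] F (false ∷ w) ℚ.+ 0ℚ)
∑-allVecs-suc n F = trans (∑-concatMap F (λ b → map (b ∷_) (allVecs n)) (true ∷ false ∷ []))
  (cong₂ (λ x y → x ℚ.+ (y ℚ.+ 0ℚ)) (∑-map F (true ∷_) (allVecs n)) (∑-map F (false ∷_) (allVecs n)))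

∑-allVecs-removeAt : ∀ n (H : Bool → Vec Bool n → ℚ) (i : Fin (suc n)) →
  ∑[ v ∈ allVecs (suc n) ] H (lookup v i) (removeAt v i) ≡ ∑[ w ∈ allVecs n ] (H true w ℚ.+ H false w)
∑-allVecs-removeAt n H zero = begin
  ∑[ v ∈ allVecs (suc n) ] H (lookup v zero) (removeAt v zero)
      ≡⟨ ∑-allVecs-suc n _ ⟩
  ∑[ w ∈ allVecs n ] H true w ℚ.+ (∑[ w ∈ allVecs n ] H false w ℚ.+ 0ℚ)
      ≡⟨ cong (∑ (allVecs n) (H true) ℚ.+_) (ℚP.+-identityʳ _) ⟩
  ∑[ w ∈ allVecs n ] H true w ℚ.+ ∑[ w ∈ allVecs n ] H false w
      ≡⟨ ∑-+ (H true) (H false) (allVecs n) ⟨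
  ∑[ w ∈ allVecs n ] (H true w ℚ.+ H false w) ∎
  where open ≡-Reasoning
∑-allVecs-removeAt (suc n) H (suc i) = begin
  ∑[ v ∈ allVecs (suc (suc n)) ] H (lookup v (suc i)) (removeAt v (suc i))
      ≡⟨ trans (∑-allVecs-suc (suc n) _) (cong₂ (λ x y → x ℚ.+ (y ℚ.+ 0ℚ)) (∑-cong (peel true) (allVecs (suc n))) (∑-cong (peel false) (allVecs (suc n)))) ⟩
  ∑[ w ∈ allVecs (suc n) ] H (lookup w i) (true ∷ removeAt w i) ℚ.+ (∑[ w ∈ allVecs (suc n) ] H (lookup w i) (false ∷ removeAt w i) ℚ.+ 0ℚ)
      ≡⟨ cong₂ (λ x y → x ℚ.+ (y ℚ.+ 0ℚ)) (∑-allVecs-removeAt n (λ c u → H c (true ∷ u)) i) (∑-allVecs-removeAt n (λ c u → H c (false ∷ u)) i) ⟩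
  ∑[ u ∈ allVecs n ] (H true (true ∷ u) ℚ.+ H false (true ∷ u)) ℚ.+ (∑[ u ∈ allVecs n ] (H true (false ∷ u) ℚ.+ H false (false ∷ u)) ℚ.+ 0ℚ)
      ≡⟨ ∑-allVecs-suc n (λ w → H true w ℚ.+ H false w) ⟨
  ∑[ w ∈ allVecs (suc n) ] (H true w ℚ.+ H false w) ∎
  where
  open ≡-Reasoning
  peel : ∀ b (w : Vec Bool (suc n)) → H (lookup (b ∷ w) (suc i)) (removeAt (b ∷ w) (suc i)) ≡ H (lookup w i) (b ∷ removeAt w i)
  peel b (_ ∷ _) = refl

signℚ : ℤ → ℚ
signℚ +[1+ _ ] = 1ℚ
signℚ (+ 0)    = 0ℚ
signℚ -[1+ _ ] = ℚ.- 1ℚ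

majoritySign : ℕ → ℕ → ℚ
majoritySign α β = if β <ᵇ α then 1ℚ else (if α <ᵇ β then ℚ.- 1ℚ else 0ℚ)

signℚ-⊖ : ∀ α β → signℚ (α ℤ.⊖ β) ≡ majoritySign α β
signℚ-⊖ zero    zero    = refl
signℚ-⊖ (suc α) zero    = refl
signℚ-⊖ zero    (suc β) = refl
signℚ-⊖ (suc α) (suc β) = trans (cong signℚ (ℤP.[1+m]⊖[1+n]≡m⊖n α β)) (signℚ-⊖ α β)

signℚ-totalAgreement : ∀ {n} (P : Vec ℤ n) v → signℚ (totalAgreement P v) ≡ majoritySign (Nplus P v) (Nminus P v)
signℚ-totalAgreement P v = begin
  signℚ (totalAgreement P v)               ≡⟨ cong signℚ (Nplus-Nminus P v) ⟨
  signℚ (+ Nplus P v ℤ.- + Nminus P v)     ≡⟨ cong signℚ (ℤP.[+m]-[+n]≡m⊖n (Nplus P v) (Nminus P v)) ⟩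
  signℚ (Nplus P v ℤ.⊖ Nminus P v)         ≡⟨ signℚ-⊖ (Nplus P v) (Nminus P v) ⟩
  majoritySign (Nplus P v) (Nminus P v)    ∎
  where open ≡-Reasoning

-- Coordinate i can only swing the majority when the other coordinates are (nearly) tied.
pivotWeight : ℤ → ℕ
pivotWeight (+ 0)     = 2
pivotWeight +[1+ 0 ]  = 1
pivotWeight -[1+ 0 ]  = 1
pivotWeight _         = 0

agreement-pivotWeight : ∀ p → p ≢ + 0 → ∀ R →
  signℚ (agreement p true) ℚ.* signℚ (agreement p true ℤ.+ R)
    ℚ.+ signℚ (agreement p false) ℚ.* signℚ (agreement p false ℤ.+ R) ≡ toℚ (pivotWeight R)
agreement-pivotWeight (+ 0)    p≢0 R            = ⊥-elim (p≢0 refl)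
agreement-pivotWeight +[1+ _ ] _   (+ 0)        = refl
agreement-pivotWeight +[1+ _ ] _   +[1+ 0 ]     = refl
agreement-pivotWeight +[1+ _ ] _   +[1+ suc _ ] = refl
agreement-pivotWeight +[1+ _ ] _   -[1+ 0 ]     = refl
agreement-pivotWeight +[1+ _ ] _   -[1+ suc _ ] = refl
agreement-pivotWeight -[1+ _ ] _   (+ 0)        = refl
agreement-pivotWeight -[1+ _ ] _   +[1+ 0 ]     = refl
agreement-pivotWeight -[1+ _ ] _   +[1+ suc _ ] = refl
agreement-pivotWeight -[1+ _ ] _   -[1+ 0 ]     = refl
agreement-pivotWeight -[1+ _ ] _   -[1+ suc _ ] = refl

walkSum : ℕ → (ℤ → ℕ) → ℤ → ℕ
walkSum zero    φ c = φ c
walkSum (suc k) φ c = walkSum k φ (c ℤ.+ + 1) + walkSum k φ (c ℤ.+ -[1+ 0 ])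

zeros : ∀ {m} → Vec ℤ m → ℕ
zeros []             = 0
zeros (+ 0 ∷ Q)      = suc (zeros Q)
zeros (+[1+ _ ] ∷ Q) = zeros Q
zeros (-[1+ _ ] ∷ Q) = zeros Q

nonzeros : ∀ {m} → Vec ℤ m → ℕ
nonzeros []             = 0
nonzeros (+ 0 ∷ Q)      = nonzeros Q
nonzeros (+[1+ _ ] ∷ Q) = suc (nonzeros Q)
nonzeros (-[1+ _ ] ∷ Q) = suc (nonzeros Q)

zeros+nonzeros : ∀ {m} (Q : Vec ℤ m) → zeros Q + nonzeros Q ≡ m
zeros+nonzeros []             = refl
zeros+nonzeros (+ 0 ∷ Q)      = cong suc (zeros+nonzeros Q)
zeros+nonzeros (+[1+ _ ] ∷ Q) = trans (+-suc (zeros Q) (nonzeros Q)) (cong suc (zeros+nonzeros Q))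
zeros+nonzeros (-[1+ _ ] ∷ Q) = trans (+-suc (zeros Q) (nonzeros Q)) (cong suc (zeros+nonzeros Q))

-- A zero coordinate contributes nothing to the total agreement, each nonzero one a fair ±1 step.
∑-allVecs-walkSum : ∀ {m} (φ : ℤ → ℕ) (Q : Vec ℤ m) c →
  ∑[ w ∈ allVecs m ] toℚ (φ (c ℤ.+ totalAgreement Q w)) ≡ toℚ (2 ^ zeros Q * walkSum (nonzeros Q) φ c)
∑-allVecs-walkSum φ []      c = trans (ℚP.+-identityʳ _) (cong toℚ (trans (cong φ (ℤP.+-identityʳ c)) (sym (*-identityˡ (φ c)))))
∑-allVecs-walkSum {suc m} φ (p ∷ Q) c = begin
  ∑[ w ∈ allVecs (suc m) ] toℚ (φ (c ℤ.+ totalAgreement (p ∷ Q) w))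
    ≡⟨ ∑-allVecs-suc m _ ⟩
  ∑[ w ∈ allVecs m ] f true w ℚ.+ (∑[ w ∈ allVecs m ] f false w ℚ.+ 0ℚ)
    ≡⟨ cong₂ (λ x y → x ℚ.+ (y ℚ.+ 0ℚ)) (∑-cong (shift true) (allVecs m)) (∑-cong (shift false) (allVecs m)) ⟩
  ∑[ w ∈ allVecs m ] toℚ (φ (c₊ true ℤ.+ totalAgreement Q w)) ℚ.+ (∑[ w ∈ allVecs m ] toℚ (φ (c₊ false ℤ.+ totalAgreement Q w)) ℚ.+ 0ℚ)
    ≡⟨ cong₂ (λ x y → x ℚ.+ (y ℚ.+ 0ℚ)) (∑-allVecs-walkSum φ Q (c₊ true)) (∑-allVecs-walkSum φ Q (c₊ false)) ⟩
  toℚ (W true) ℚ.+ (toℚ (W false) ℚ.+ 0ℚ)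
    ≡⟨ cong (toℚ (W true) ℚ.+_) (ℚP.+-identityʳ _) ⟩
  toℚ (W true) ℚ.+ toℚ (W false)
    ≡⟨ toℚ-+ (W true) (W false) ⟨
  toℚ (W true + W false)
    ≡⟨ cong toℚ (split p) ⟩
  toℚ (2 ^ zeros (p ∷ Q) * walkSum (nonzeros (p ∷ Q)) φ c) ∎
  where
  open ≡-Reasoning
  c₊ : Bool → ℤ
  c₊ b = c ℤ.+ agreement p b
  f : Bool → Vec Bool m → ℚ
  f b w = toℚ (φ (c ℤ.+ totalAgreement (p ∷ Q) (b ∷ w)))
  shift : ∀ b w → f b w ≡ toℚ (φ (c₊ b ℤ.+ totalAgreement Q w))
  shift b w = cong (toℚ ∘ φ) (sym (ℤP.+-assoc c (agreement p b) (totalAgreement Q w)))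
  W : Bool → ℕ
  W b = 2 ^ zeros Q * walkSum (nonzeros Q) φ (c₊ b)
  split : ∀ p → 2 ^ zeros Q * walkSum (nonzeros Q) φ (c ℤ.+ agreement p true)
              + 2 ^ zeros Q * walkSum (nonzeros Q) φ (c ℤ.+ agreement p false)
              ≡ 2 ^ zeros (p ∷ Q) * walkSum (nonzeros (p ∷ Q)) φ c
  split (+ 0)    = begin
    X′ (c ℤ.+ + 0) + X′ (c ℤ.+ + 0) ≡⟨ cong (λ d → X′ d + X′ d) (ℤP.+-identityʳ c) ⟩
    X′ c + X′ c                     ≡⟨ cong (_+_ (X′ c)) (+-identityʳ (X′ c)) ⟨
    2 * X′ c                        ≡⟨ *-assoc 2 (2 ^ zeros Q) _ ⟨
    2 ^ suc (zeros Q) * walkSum (nonzeros Q) φ c ∎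
    where X′ = λ d → 2 ^ zeros Q * walkSum (nonzeros Q) φ d
  split +[1+ _ ] = sym (*-distribˡ-+ (2 ^ zeros Q) _ _)
  split -[1+ _ ] = trans (+-comm (2 ^ zeros Q * walkSum (nonzeros Q) φ (c ℤ.+ -[1+ 0 ])) _) (sym (*-distribˡ-+ (2 ^ zeros Q) _ _))

-- Lattice paths and the central binomial coefficient

-- paths a b = (a + b choose a) counts the ±1-walks with a up-steps and b down-steps.
paths : ℕ → ℕ → ℕ
paths zero    b       = 1
paths (suc a) zero    = 1
paths (suc a) (suc b) = paths a (suc b) + paths (suc a) b

paths-zeroʳ : ∀ a → paths a 0 ≡ 1
paths-zeroʳ zero    = refl
paths-zeroʳ (suc a) = refl

paths≤walkSum : ∀ (φ : ℤ → ℕ) k a b → a + b ≡ k → ∀ c₀ c → c ≡ c₀ ℤ.+ (+ b ℤ.- + a) →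
                paths a b * φ c₀ ≤ walkSum k φ c
paths≤walkSum φ zero    zero    zero    _  c₀ c c≡ =
  ≤-reflexive (trans (*-identityˡ (φ c₀)) (cong φ (sym (trans c≡ (ℤP.+-identityʳ c₀)))))
paths≤walkSum φ (suc k) zero    (suc b) eq c₀ c c≡ =
  ≤-trans (paths≤walkSum φ k zero b (suc-injective eq) c₀ (c ℤ.+ -[1+ 0 ]) c≡′) (m≤n+m _ _)
  where
  open ℤ-Solver.+-*-Solver
  c≡′ : c ℤ.+ -[1+ 0 ] ≡ c₀ ℤ.+ (+ b ℤ.- + 0)
  c≡′ = trans (cong (ℤ._+ -[1+ 0 ]) c≡)
    (solve 2 (λ x y → x :+ ((con (+ 1) :+ y) :- con (+ 0)) :+ con -[1+ 0 ] := x :+ (y :- con (+ 0))) refl c₀ (+ b))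
paths≤walkSum φ (suc k) (suc a) zero    eq c₀ c c≡ =
  ≤-trans (subst (λ z → z * φ c₀ ≤ walkSum k φ (c ℤ.+ + 1)) (paths-zeroʳ a)
            (paths≤walkSum φ k a zero (trans (+-identityʳ a) (suc-injective (trans (sym (+-identityʳ (suc a))) eq))) c₀ (c ℤ.+ + 1) c≡′))
          (m≤m+n _ _)
  where
  open ℤ-Solver.+-*-Solver
  c≡′ : c ℤ.+ + 1 ≡ c₀ ℤ.+ (+ 0 ℤ.- + a)
  c≡′ = trans (cong (ℤ._+ + 1) c≡)
    (solve 2 (λ x y → x :+ (con (+ 0) :- (con (+ 1) :+ y)) :+ con (+ 1) := x :+ (con (+ 0) :- y)) refl c₀ (+ a))
paths≤walkSum φ (suc k) (suc a) (suc b) eq c₀ c c≡ = begin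
  (paths a (suc b) + paths (suc a) b) * φ c₀                ≡⟨ *-distribʳ-+ (φ c₀) (paths a (suc b)) _ ⟩
  paths a (suc b) * φ c₀ + paths (suc a) b * φ c₀
    ≤⟨ +-mono-≤ (paths≤walkSum φ k a (suc b) (suc-injective eq) c₀ (c ℤ.+ + 1) c≡₊)
                (paths≤walkSum φ k (suc a) b (suc-injective (trans (cong suc (sym (+-suc a b))) eq)) c₀ (c ℤ.+ -[1+ 0 ]) c≡₋) ⟩
  walkSum (suc k) φ c                                       ∎
  where
  open ≤-Reasoning
  open ℤ-Solver.+-*-Solver
  c≡₊ : c ℤ.+ + 1 ≡ c₀ ℤ.+ (+ suc b ℤ.- + a)
  c≡₊ = trans (cong (ℤ._+ + 1) c≡)
    (solve 3 (λ x y z → x :+ ((con (+ 1) :+ y) :- (con (+ 1) :+ z)) :+ con (+ 1) := x :+ ((con (+ 1) :+ y) :- z)) refl c₀ (+ b) (+ a))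
  c≡₋ : c ℤ.+ -[1+ 0 ] ≡ c₀ ℤ.+ (+ b ℤ.- + suc a)
  c≡₋ = trans (cong (ℤ._+ -[1+ 0 ]) c≡)
    (solve 3 (λ x y z → x :+ ((con (+ 1) :+ y) :- (con (+ 1) :+ z)) :+ con -[1+ 0 ] := x :+ (y :- (con (+ 1) :+ z))) refl c₀ (+ b) (+ a))

paths-comm : ∀ a b → paths a b ≡ paths b a
paths-comm zero    zero    = refl
paths-comm zero    (suc b) = refl
paths-comm (suc a) zero    = refl
paths-comm (suc a) (suc b) =
  trans (cong₂ _+_ (paths-comm a (suc b)) (paths-comm (suc a) b)) (+-comm (paths (suc b) a) (paths b (suc a)))

paths-absorb : ∀ k a b → a + b ≡ k → suc a * paths (suc a) b ≡ (suc a + b) * paths a b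
paths-absorb k       a zero    eq rewrite paths-zeroʳ a | paths-zeroʳ (suc a) = cong (_* 1) (sym (+-identityʳ (suc a)))
paths-absorb zero    a (suc b) eq = ⊥-elim (1+n≢0 (trans (sym (+-suc a b)) eq))
paths-absorb (suc k) a (suc b) eq = begin
  suc a * (paths a (suc b) + paths (suc a) b)                   ≡⟨ *-distribˡ-+ (suc a) (paths a (suc b)) _ ⟩
  suc a * paths a (suc b) + suc a * paths (suc a) b             ≡⟨ cong (_+_ (suc a * paths a (suc b))) (paths-absorb k a b a+b≡k) ⟩
  suc a * paths a (suc b) + (suc a + b) * paths a b             ≡⟨ cong (_+_ (suc a * paths a (suc b))) mirror ⟩
  suc a * paths a (suc b) + suc b * paths a (suc b)             ≡⟨ *-distribʳ-+ (paths a (suc b)) (suc a) (suc b) ⟨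
  (suc a + suc b) * paths a (suc b)                             ∎
  where
  open ≡-Reasoning
  a+b≡k : a + b ≡ k
  a+b≡k = suc-injective (trans (sym (+-suc a b)) eq)
  mirror : (suc a + b) * paths a b ≡ suc b * paths a (suc b)
  mirror = begin
    (suc a + b) * paths a b    ≡⟨ cong₂ _*_ (cong suc (+-comm a b)) (paths-comm a b) ⟩
    (suc b + a) * paths b a    ≡⟨ paths-absorb k b a (trans (+-comm b a) a+b≡k) ⟨
    suc b * paths (suc b) a    ≡⟨ cong (suc b *_) (paths-comm (suc b) a) ⟩
    suc b * paths a (suc b)    ∎

paths-central-suc : ∀ h → suc h * paths (suc h) (suc h) ≡ 2 * ((h + suc h) * paths h h)
paths-central-suc h = begin
  suc h * (paths h (suc h) + paths (suc h) h)   ≡⟨ cong (λ x → suc h * (x + paths (suc h) h)) (paths-comm h (suc h)) ⟩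
  suc h * (paths (suc h) h + paths (suc h) h)   ≡⟨ solve 2 (λ a x → a :* (x :+ x) := con 2 :* (a :* x)) refl (suc h) (paths (suc h) h) ⟩
  2 * (suc h * paths (suc h) h)                 ≡⟨ cong (2 *_) (paths-absorb (h + h) h h refl) ⟩
  2 * ((suc h + h) * paths h h)                 ≡⟨ cong (λ x → 2 * (x * paths h h)) (sym (+-suc h h)) ⟩
  2 * ((h + suc h) * paths h h)                 ∎
  where
  open ≡-Reasoning
  open ℕ-Solver.+-*-Solver

sq : ℕ → ℕ
sq x = x * x

sq-mono-≤ : ∀ {x y} → x ≤ y → sq x ≤ sq y
sq-mono-≤ x≤y = *-mono-≤ x≤y x≤y

sq-cancel-≤ : ∀ {x y} → sq x ≤ sq y → x ≤ y
sq-cancel-≤ {x} {y} h with x ≤? y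
... | yes x≤y = x≤y
... | no  x≰y = ⊥-elim (<⇒≱ (*-mono-< (≰⇒> x≰y) (≰⇒> x≰y)) h)

paths-central-≥ : ∀ h → 4 ^ h * 4 ^ h ≤ sq (paths h h) * (4 * h + 1)
paths-central-≥ zero    = ≤-refl
paths-central-≥ (suc h) = *-cancelˡ-≤ (sq (suc h)) (begin
  sq (suc h) * (4 ^ suc h * 4 ^ suc h)               ≡⟨ solve 2 (λ a x → (a :* a) :* ((con 4 :* x) :* (con 4 :* x)) := con 16 :* (a :* a) :* (x :* x)) refl (suc h) (4 ^ h) ⟩
  16 * sq (suc h) * (4 ^ h * 4 ^ h)                  ≤⟨ *-monoʳ-≤ (16 * sq (suc h)) (paths-central-≥ h) ⟩
  16 * sq (suc h) * (sq c * (4 * h + 1))             ≤⟨ m≤m+n _ (4 * sq c) ⟩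
  16 * sq (suc h) * (sq c * (4 * h + 1)) + 4 * sq c
    ≡⟨ solve 2 (λ a x → con 16 :* ((con 1 :+ a) :* (con 1 :+ a)) :* ((x :* x) :* (con 4 :* a :+ con 1)) :+ (con 4 :* (x :* x))
                      := (con 2 :* ((a :+ (con 1 :+ a)) :* x)) :* (con 2 :* ((a :+ (con 1 :+ a)) :* x)) :* (con 4 :* (con 1 :+ a) :+ con 1)) refl h c ⟩
  sq (2 * ((h + suc h) * c)) * (4 * suc h + 1)       ≡⟨ cong (λ x → sq x * (4 * suc h + 1)) (sym (paths-central-suc h)) ⟩
  sq (suc h * c′) * (4 * suc h + 1)                  ≡⟨ solve 3 (λ a x y → (a :* x) :* (a :* x) :* y := (a :* a) :* ((x :* x) :* y)) refl (suc h) c′ (4 * suc h + 1) ⟩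
  sq (suc h) * (sq c′ * (4 * suc h + 1))             ∎)
  where
  open ≤-Reasoning
  open ℕ-Solver.+-*-Solver
  c  = paths h h
  c′ = paths (suc h) (suc h)

pivotalMass : ℕ → ℕ
pivotalMass k = walkSum k pivotWeight (+ 0)

even-or-odd : ∀ k → Σ[ h ∈ ℕ ] k ≡ h + h ⊎ Σ[ h ∈ ℕ ] k ≡ suc (h + h)
even-or-odd zero = inj₁ (0 , refl)
even-or-odd (suc k) with even-or-odd k
... | inj₁ (h , k≡) = inj₂ (h , cong suc k≡)
... | inj₂ (h , k≡) = inj₁ (suc h , trans (cong suc k≡) (cong suc (sym (+-suc h h))))

-- For k = 2h the walks ending at 0 have weight 2; for k = 2h + 1 those ending at ±1 have weight 1.
pivotalMass-≥ : ∀ k → 4 ^ k ≤ sq (pivotalMass k) * (2 * k + 3)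
pivotalMass-≥ k with even-or-odd k
... | inj₁ (h , refl) = begin
  4 ^ (h + h)                                   ≡⟨ ^-distribˡ-+-* 4 h h ⟩
  4 ^ h * 4 ^ h                                 ≤⟨ paths-central-≥ h ⟩
  sq c * (4 * h + 1)                            ≤⟨ m≤m+n _ (sq c * (12 * h + 11)) ⟩
  sq c * (4 * h + 1) + sq c * (12 * h + 11)
    ≡⟨ solve 2 (λ x a → (x :* x) :* (con 4 :* a :+ con 1) :+ (x :* x) :* (con 12 :* a :+ con 11) := ((x :* con 2) :* (x :* con 2)) :* (con 2 :* (a :+ a) :+ con 3)) refl c h ⟩
  sq (c * 2) * (2 * (h + h) + 3)                ≤⟨ *-monoˡ-≤ (2 * (h + h) + 3) (sq-mono-≤ 2c≤L) ⟩
  sq (pivotalMass (h + h)) * (2 * (h + h) + 3)  ∎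
  where
  open ≤-Reasoning
  open ℕ-Solver.+-*-Solver
  c = paths h h
  2c≤L : c * 2 ≤ pivotalMass (h + h)
  2c≤L = paths≤walkSum pivotWeight (h + h) h h refl (+ 0) (+ 0) (sym (trans (ℤP.+-identityˡ _) (ℤP.+-inverseʳ (+ h))))
... | inj₂ (h , refl) = *-cancelˡ-≤ 4 (begin
  4 * 4 ^ suc (h + h)                           ≡⟨ cong (λ y → 4 * (4 * y)) (^-distribˡ-+-* 4 h h) ⟩
  4 * (4 * (4 ^ h * 4 ^ h))                     ≡⟨ solve 1 (λ x → con 4 :* (con 4 :* (x :* x)) := (con 4 :* x) :* (con 4 :* x)) refl (4 ^ h) ⟩
  4 ^ suc h * 4 ^ suc h                         ≤⟨ paths-central-≥ (suc h) ⟩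
  sq c′ * (4 * suc h + 1)                       ≡⟨ cong (λ x → sq x * (4 * suc h + 1)) c′≡2X ⟩
  sq (2 * X) * (4 * suc h + 1)
    ≡⟨ solve 2 (λ x a → ((con 2 :* x) :* (con 2 :* x)) :* (con 4 :* (con 1 :+ a) :+ con 1) := con 4 :* ((x :* x) :* (con 2 :* (con 1 :+ (a :+ a)) :+ con 3))) refl X h ⟩
  4 * (sq X * (2 * suc (h + h) + 3))            ≤⟨ *-monoʳ-≤ 4 (*-monoˡ-≤ (2 * suc (h + h) + 3) (sq-mono-≤ X≤L)) ⟩
  4 * (sq (pivotalMass (suc (h + h))) * (2 * suc (h + h) + 3)) ∎)
  where
  open ≤-Reasoning
  open ℕ-Solver.+-*-Solver
  X  = paths h (suc h)
  c′ = paths (suc h) (suc h)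
  c′≡2X : c′ ≡ 2 * X
  c′≡2X = trans (cong (_+_ X) (paths-comm (suc h) h)) (cong (_+_ X) (sym (+-identityʳ X)))
  offset : -[1+ 0 ] ℤ.+ (+ suc h ℤ.- + h) ≡ + 0
  offset = cong (ℤ._+_ -[1+ 0 ])
    (trans (ℤP.+-assoc (+ 1) (+ h) (ℤ.- + h)) (cong (ℤ._+_ (+ 1)) (ℤP.+-inverseʳ (+ h))))
  X≤L : X ≤ pivotalMass (suc (h + h))
  X≤L = subst (_≤ pivotalMass (suc (h + h))) (*-identityʳ X)
    (paths≤walkSum pivotWeight (suc (h + h)) h (suc h) (+-suc h h) -[1+ 0 ] (+ 0) (sym offset))

2^n≤s*pivotal : ∀ s m z k → z + k ≡ m → 8 * suc m + 4 ≤ sq s → 2 ^ suc m ≤ s * (2 ^ z * pivotalMass k)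
2^n≤s*pivotal s m z k z+k≡m 8m+12≤s² = sq-cancel-≤ (begin
  sq (2 ^ suc m)                        ≡⟨ sq-2^ (suc m) ⟩
  4 ^ suc m                             ≡⟨ cong (λ x → 4 * 4 ^ x) (sym z+k≡m) ⟩
  4 * 4 ^ (z + k)                       ≡⟨ cong (4 *_) (^-distribˡ-+-* 4 z k) ⟩
  4 * (4 ^ z * 4 ^ k)                   ≤⟨ *-monoʳ-≤ 4 (*-monoʳ-≤ (4 ^ z) (pivotalMass-≥ k)) ⟩
  4 * (4 ^ z * (sq L * (2 * k + 3)))    ≡⟨ solve 3 (λ a b c → con 4 :* (a :* (b :* (con 2 :* c :+ con 3))) := (a :* b) :* (con 8 :* c :+ con 12)) refl (4 ^ z) (sq L) k ⟩
  (4 ^ z * sq L) * (8 * k + 12)         ≤⟨ *-monoʳ-≤ (4 ^ z * sq L) (+-monoˡ-≤ 12 (*-monoʳ-≤ 8 k≤m)) ⟩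
  (4 ^ z * sq L) * (8 * m + 12)         ≡⟨ cong (λ x → (4 ^ z * sq L) * x) (solve 1 (λ a → con 8 :* a :+ con 12 := con 8 :* (con 1 :+ a) :+ con 4) refl m) ⟩
  (4 ^ z * sq L) * (8 * suc m + 4)      ≤⟨ *-monoʳ-≤ (4 ^ z * sq L) 8m+12≤s² ⟩
  (4 ^ z * sq L) * sq s                 ≡⟨ cong (λ x → (x * sq L) * sq s) (sym (sq-2^ z)) ⟩
  (sq (2 ^ z) * sq L) * sq s            ≡⟨ solve 3 (λ a b c → ((a :* a) :* (b :* b)) :* (c :* c) := (c :* (a :* b)) :* (c :* (a :* b))) refl (2 ^ z) L s ⟩
  sq (s * (2 ^ z * L))                  ∎)
  where
  open ≤-Reasoning
  open ℕ-Solver.+-*-Solver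
  L = pivotalMass k
  k≤m : k ≤ m
  k≤m = subst (k ≤_) z+k≡m (m≤n+m k z)
  sq-2^ : ∀ j → sq (2 ^ j) ≡ 4 ^ j
  sq-2^ zero    = refl
  sq-2^ (suc j) = trans (solve 1 (λ x → (con 2 :* x) :* (con 2 :* x) := con 4 :* (x :* x)) refl (2 ^ j)) (cong (4 *_) (sq-2^ j))

-- Drift of the potential

infixr 8 _^ℚ_
_^ℚ_ : ℚ → ℕ → ℚ
x ^ℚ zero  = 1ℚ
x ^ℚ suc k = x ℚ.* x ^ℚ k

0≤^ℚ : ∀ {x} → 0ℚ ℚ.≤ x → ∀ k → 0ℚ ℚ.≤ x ^ℚ k
0≤^ℚ 0≤x zero    = ℚP.<⇒≤ (ℚP.positive⁻¹ 1ℚ)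
0≤^ℚ 0≤x (suc k) = 0≤* 0≤x (0≤^ℚ 0≤x k)

^ℚ-+ : ∀ x a b → x ^ℚ (a + b) ≡ x ^ℚ a ℚ.* x ^ℚ b
^ℚ-+ x zero    b = sym (ℚP.*-identityˡ (x ^ℚ b))
^ℚ-+ x (suc a) b = trans (cong (x ℚ.*_) (^ℚ-+ x a b)) (sym (ℚP.*-assoc x (x ^ℚ a) (x ^ℚ b)))

^ℚ-* : ∀ x a b → x ^ℚ (a * b) ≡ (x ^ℚ a) ^ℚ b
^ℚ-* x a zero    = cong (x ^ℚ_) (*-zeroʳ a)
^ℚ-* x a (suc b) = trans (cong (x ^ℚ_) (*-suc a b)) (trans (^ℚ-+ x a (a * b)) (cong (x ^ℚ a ℚ.*_) (^ℚ-* x a b)))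

^ℚ-monoˡ-≤ : ∀ {x y} → 0ℚ ℚ.≤ x → x ℚ.≤ y → ∀ k → x ^ℚ k ℚ.≤ y ^ℚ k
^ℚ-monoˡ-≤ 0≤x x≤y zero = ℚP.≤-refl
^ℚ-monoˡ-≤ {x} {y} 0≤x x≤y (suc k) = begin
  x ℚ.* x ^ℚ k     ≤⟨ *-monoˡ-≤-0≤ 0≤x (^ℚ-monoˡ-≤ 0≤x x≤y k) ⟩
  x ℚ.* y ^ℚ k     ≡⟨ ℚP.*-comm x (y ^ℚ k) ⟩
  y ^ℚ k ℚ.* x     ≤⟨ *-monoˡ-≤-0≤ (0≤^ℚ (ℚP.≤-trans 0≤x x≤y) k) x≤y ⟩
  y ^ℚ k ℚ.* y     ≡⟨ ℚP.*-comm (y ^ℚ k) y ⟩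
  y ℚ.* y ^ℚ k     ∎
  where open ℚP.≤-Reasoning

toℚ-^ : ∀ a k → toℚ (a ^ k) ≡ toℚ a ^ℚ k
toℚ-^ a zero    = ℚP.+-identityʳ 1ℚ
toℚ-^ a (suc k) = trans (toℚ-* a (a ^ k)) (cong (toℚ a ℚ.*_) (toℚ-^ a k))

majorityMove : ℕ → ℕ → Bool → ℤ
majorityMove α β c = if β <ᵇ α then -[1+ 0 ] else (if α <ᵇ β then + 1 else sgn c)

-- Sum of x ^ |P(i)| after one round, over the tie-breaking coin; α, β play the roles of N₊, N₋.
coinSum : ℚ → ℤ → ℕ → ℕ → Bool → ℚ
coinSum x p α β b = ∑ (true ∷ false ∷ []) (λ c → x ^ℚ ∣ p ℤ.+ majorityMove α β c ℤ.* sgn b ∣)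

potential : ∀ {n} → ℚ → Fin n → Vec ℤ n → ℚ
potential x i P = x ^ℚ ∣ lookup P i ∣

stepTotal-potential : ∀ {n} x (i : Fin n) (P : Vec ℤ n) →
  stepTotal (potential x i) P ≡ ∑[ v ∈ allVecs n ] coinSum x (lookup P i) (Nplus P v) (Nminus P v) (lookup v i)
stepTotal-potential {n} x i P =
  trans (∑-concatMap (λ r → potential x i (step P r)) (λ v → map (v ,_) (true ∷ false ∷ [])) (allVecs n))
        (∑-cong (λ v → cong₂ (λ u w → x ^ℚ ∣ u ∣ ℚ.+ (x ^ℚ ∣ w ∣ ℚ.+ 0ℚ))
                   (VP.lookup-zipWith (λ p b → p ℤ.+ chooseX P v true ℤ.* sgn b) i P v)
                   (VP.lookup-zipWith (λ p b → p ℤ.+ chooseX P v false ℤ.* sgn b) i P v))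
                (allVecs n))

coinSum-zero : ∀ x α β b → coinSum x (+ 0) α β b ≡ x ^ℚ 1 ℚ.+ (x ^ℚ 1 ℚ.+ 0ℚ)
coinSum-zero x α β b with β <ᵇ α | α <ᵇ β | b
... | true  | _     | true  = refl
... | true  | _     | false = refl
... | false | true  | true  = refl
... | false | true  | false = refl
... | false | false | true  = refl
... | false | false | false = refl

-- With A = x ^ (|p| + 1) and B = x ^ (|p| - 1), the coin sum is A + B - θ (A - B), where
-- θ = ±1 when both coins move P(i) towards/away from 0 and θ = 0 on a tie.
module _ (A B : ℚ) where
  open ℚ-Solver.+-*-Solver

  both-toward : B ℚ.+ (B ℚ.+ 0ℚ) ≡ (A ℚ.+ B) ℚ.- (1ℚ ℚ.* 1ℚ) ℚ.* (A ℚ.- B)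
  both-toward = solve 2 (λ a b → b :+ (b :+ con 0ℚ) := (a :+ b) :- (con 1ℚ :* con 1ℚ) :* (a :- b)) refl A B

  both-away : ∀ {θ} → θ ≡ ℚ.- 1ℚ → A ℚ.+ (A ℚ.+ 0ℚ) ≡ (A ℚ.+ B) ℚ.- θ ℚ.* (A ℚ.- B)
  both-away refl = solve 2 (λ a b → a :+ (a :+ con 0ℚ) := (a :+ b) :- con (ℚ.- 1ℚ) :* (a :- b)) refl A B

  tie : ∀ {θ} → θ ≡ 0ℚ → A ℚ.+ (B ℚ.+ 0ℚ) ≡ (A ℚ.+ B) ℚ.- θ ℚ.* (A ℚ.- B)
  tie refl = solve 2 (λ a b → a :+ (b :+ con 0ℚ) := (a :+ b) :- con 0ℚ :* (a :- b)) refl A B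

  tie′ : ∀ {θ} → θ ≡ 0ℚ → B ℚ.+ (A ℚ.+ 0ℚ) ≡ (A ℚ.+ B) ℚ.- θ ℚ.* (A ℚ.- B)
  tie′ refl = solve 2 (λ a b → b :+ (a :+ con 0ℚ) := (a :+ b) :- con 0ℚ :* (a :- b)) refl A B

∣-[1+y]+1∣ : ∀ y → ∣ -[1+ y ] ℤ.+ + 1 ∣ ≡ y
∣-[1+y]+1∣ zero    = refl
∣-[1+y]+1∣ (suc y) = refl

∣-[2+y]∣ : ∀ y → ∣ -[1+ y ] ℤ.+ -[1+ 0 ] ∣ ≡ suc (suc y)
∣-[2+y]∣ y = cong (λ m → suc (suc m)) (+-identityʳ y)

coinSum-nonzero : ∀ x y p → ∣ p ∣ ≡ suc y → ∀ α β b → coinSum x p α β b ≡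
  (x ^ℚ (2 + y) ℚ.+ x ^ℚ y) ℚ.- (signℚ (agreement p b) ℚ.* majoritySign α β) ℚ.* (x ^ℚ (2 + y) ℚ.- x ^ℚ y)
coinSum-nonzero x y +[1+ .y ] refl α β b with β <ᵇ α | α <ᵇ β | b
... | true  | _     | true  = both-toward (x ^ℚ (2 + y)) (x ^ℚ y)
... | true  | _     | false = trans (cong₂ (λ u w → x ^ℚ u ℚ.+ (x ^ℚ w ℚ.+ 0ℚ)) (cong suc (+-comm y 1)) (cong suc (+-comm y 1))) (both-away (x ^ℚ (2 + y)) (x ^ℚ y) refl)
... | false | true  | true  = trans (cong₂ (λ u w → x ^ℚ u ℚ.+ (x ^ℚ w ℚ.+ 0ℚ)) (cong suc (+-comm y 1)) (cong suc (+-comm y 1))) (both-away (x ^ℚ (2 + y)) (x ^ℚ y) refl)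
... | false | true  | false = both-toward (x ^ℚ (2 + y)) (x ^ℚ y)
... | false | false | true  = trans (cong (λ u → x ^ℚ u ℚ.+ (x ^ℚ y ℚ.+ 0ℚ)) (cong suc (+-comm y 1))) (tie (x ^ℚ (2 + y)) (x ^ℚ y) refl)
... | false | false | false = trans (cong (λ u → x ^ℚ y ℚ.+ (x ^ℚ u ℚ.+ 0ℚ)) (cong suc (+-comm y 1))) (tie′ (x ^ℚ (2 + y)) (x ^ℚ y) refl)
coinSum-nonzero x y -[1+ .y ] refl α β b with β <ᵇ α | α <ᵇ β | b
... | true  | _     | false = trans (cong₂ (λ u w → x ^ℚ u ℚ.+ (x ^ℚ w ℚ.+ 0ℚ)) (∣-[1+y]+1∣ y) (∣-[1+y]+1∣ y)) (both-toward (x ^ℚ (2 + y)) (x ^ℚ y))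
... | true  | _     | true  = trans (cong₂ (λ u w → x ^ℚ u ℚ.+ (x ^ℚ w ℚ.+ 0ℚ)) (∣-[2+y]∣ y) (∣-[2+y]∣ y)) (both-away (x ^ℚ (2 + y)) (x ^ℚ y) refl)
... | false | true  | false = trans (cong₂ (λ u w → x ^ℚ u ℚ.+ (x ^ℚ w ℚ.+ 0ℚ)) (∣-[2+y]∣ y) (∣-[2+y]∣ y)) (both-away (x ^ℚ (2 + y)) (x ^ℚ y) refl)
... | false | true  | true  = trans (cong₂ (λ u w → x ^ℚ u ℚ.+ (x ^ℚ w ℚ.+ 0ℚ)) (∣-[1+y]+1∣ y) (∣-[1+y]+1∣ y)) (both-toward (x ^ℚ (2 + y)) (x ^ℚ y))
... | false | false | false = trans (cong₂ (λ u w → x ^ℚ u ℚ.+ (x ^ℚ w ℚ.+ 0ℚ)) (∣-[2+y]∣ y) (∣-[1+y]+1∣ y)) (tie (x ^ℚ (2 + y)) (x ^ℚ y) refl)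
... | false | false | true  = trans (cong₂ (λ u w → x ^ℚ u ℚ.+ (x ^ℚ w ℚ.+ 0ℚ)) (∣-[1+y]+1∣ y) (∣-[2+y]∣ y)) (tie′ (x ^ℚ (2 + y)) (x ^ℚ y) refl)

∑-agreement*majority : ∀ {m} (P : Vec ℤ (suc m)) i p → lookup P i ≡ p → p ≢ + 0 →
  ∑[ v ∈ allVecs (suc m) ] (signℚ (agreement p (lookup v i)) ℚ.* majoritySign (Nplus P v) (Nminus P v))
    ≡ toℚ (2 ^ zeros (removeAt P i) * pivotalMass (nonzeros (removeAt P i)))
∑-agreement*majority {m} P i p P[i]≡p p≢0 = begin
  ∑[ v ∈ allVecs (suc m) ] (signℚ (agreement p (lookup v i)) ℚ.* majoritySign (Nplus P v) (Nminus P v))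
    ≡⟨ ∑-cong split (allVecs (suc m)) ⟩
  ∑[ v ∈ allVecs (suc m) ] H (lookup v i) (removeAt v i)
    ≡⟨ ∑-allVecs-removeAt m H i ⟩
  ∑[ w ∈ allVecs m ] (H true w ℚ.+ H false w)
    ≡⟨ ∑-cong (λ w → trans (agreement-pivotWeight p p≢0 (totalAgreement P′ w))
                           (cong (toℚ ∘ pivotWeight) (sym (ℤP.+-identityˡ (totalAgreement P′ w))))) (allVecs m) ⟩
  ∑[ w ∈ allVecs m ] toℚ (pivotWeight (+ 0 ℤ.+ totalAgreement P′ w))
    ≡⟨ ∑-allVecs-walkSum pivotWeight P′ (+ 0) ⟩
  toℚ (2 ^ zeros P′ * pivotalMass (nonzeros P′)) ∎
  where
  open ≡-Reasoning
  P′ = removeAt P i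
  H : Bool → Vec Bool m → ℚ
  H b w = signℚ (agreement p b) ℚ.* signℚ (agreement p b ℤ.+ totalAgreement P′ w)
  split : ∀ v → signℚ (agreement p (lookup v i)) ℚ.* majoritySign (Nplus P v) (Nminus P v) ≡ H (lookup v i) (removeAt v i)
  split v = cong (signℚ (agreement p (lookup v i)) ℚ.*_) (begin
    majoritySign (Nplus P v) (Nminus P v)
      ≡⟨ signℚ-totalAgreement P v ⟨
    signℚ (totalAgreement P v)
      ≡⟨ cong signℚ (totalAgreement-removeAt P v i) ⟩
    signℚ (agreement (lookup P i) (lookup v i) ℤ.+ totalAgreement P′ (removeAt v i))
      ≡⟨ cong (λ q → signℚ (agreement q (lookup v i) ℤ.+ totalAgreement P′ (removeAt v i))) P[i]≡p ⟩
    signℚ (agreement p (lookup v i) ℤ.+ totalAgreement P′ (removeAt v i)) ∎)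

module Drift (s′ : ℕ) (e : ℚ) (s*e≡1 : toℚ (suc s′) ℚ.* e ≡ 1ℚ) (0≤e : 0ℚ ℚ.≤ e) where

  s : ℕ
  s = suc s′

  ρ γ β : ℚ
  ρ = 1ℚ ℚ.+ e
  γ = e ℚ.* e ℚ.* ℚ.½
  β = e ℚ.+ γ

  0≤ρ : 0ℚ ℚ.≤ ρ
  0≤ρ = ℚP.≤-trans 0≤e (ℚP.≤-trans (ℚP.≤-reflexive (sym (ℚP.+-identityˡ e))) (ℚP.+-monoˡ-≤ e (ℚP.<⇒≤ (ℚP.positive⁻¹ 1ℚ))))

  0≤γ : 0ℚ ℚ.≤ γ
  0≤γ = 0≤* (0≤* 0≤e 0≤e) (ℚP.<⇒≤ (ℚP.positive⁻¹ ℚ.½))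

  ρ²B-B≥0 : ∀ B → 0ℚ ℚ.≤ B → 0ℚ ℚ.≤ ρ ℚ.* (ρ ℚ.* B) ℚ.- B
  ρ²B-B≥0 B 0≤B = ℚP.≤-trans (0≤* (ℚP.+-mono-≤ (ℚP.+-mono-≤ 0≤e 0≤e) (0≤* 0≤e 0≤e)) 0≤B)
    (ℚP.≤-reflexive (solve 2 (λ a b → ((a :+ a) :+ a :* a) :* b := (con 1ℚ :+ a) :* ((con 1ℚ :+ a) :* b) :- b) refl e B))
    where open ℚ-Solver.+-*-Solver

  -- If a 1/s fraction of the M vectors is pivotal, the potential contracts: this is where e = 1/s enters.
  nonzero-drift : ∀ M K B → 0ℚ ℚ.≤ M → 0ℚ ℚ.≤ B → M ℚ.≤ toℚ s ℚ.* K →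
    M ℚ.* (ρ ℚ.* (ρ ℚ.* B) ℚ.+ B) ℚ.- K ℚ.* (ρ ℚ.* (ρ ℚ.* B) ℚ.- B)
      ℚ.≤ (toℚ 2 ℚ.* M) ℚ.* ((1ℚ ℚ.- γ) ℚ.* (ρ ℚ.* B) ℚ.+ β)
  nonzero-drift M K B 0≤M 0≤B M≤sK = begin
    M ℚ.* (A ℚ.+ B) ℚ.- K ℚ.* (A ℚ.- B)          ≤⟨ ℚP.+-monoʳ-≤ (M ℚ.* (A ℚ.+ B)) (ℚP.neg-antimono-≤ eM≤K) ⟩
    M ℚ.* (A ℚ.+ B) ℚ.- (e ℚ.* M) ℚ.* (A ℚ.- B)
      ≡⟨ solve 3 (λ m b x → (m :* ((con 1ℚ :+ x) :* ((con 1ℚ :+ x) :* b) :+ b)) :- (x :* m) :* ((con 1ℚ :+ x) :* ((con 1ℚ :+ x) :* b) :- b)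
                         := (con (toℚ 2) :* m) :* ((con 1ℚ :- x :* x :* con ℚ.½) :* ((con 1ℚ :+ x) :* b) :+ con 0ℚ)) refl M B e ⟩
    (toℚ 2 ℚ.* M) ℚ.* ((1ℚ ℚ.- γ) ℚ.* (ρ ℚ.* B) ℚ.+ 0ℚ)
      ≤⟨ *-monoˡ-≤-0≤ (0≤* (0≤toℚ 2) 0≤M) (ℚP.+-monoʳ-≤ ((1ℚ ℚ.- γ) ℚ.* (ρ ℚ.* B)) (ℚP.+-mono-≤ 0≤e 0≤γ)) ⟩
    (toℚ 2 ℚ.* M) ℚ.* ((1ℚ ℚ.- γ) ℚ.* (ρ ℚ.* B) ℚ.+ β) ∎
    where
    open ℚP.≤-Reasoning
    open ℚ-Solver.+-*-Solver
    A = ρ ℚ.* (ρ ℚ.* B)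
    e*s*K≡K : e ℚ.* (toℚ s ℚ.* K) ≡ K
    e*s*K≡K = trans (sym (ℚP.*-assoc e (toℚ s) K)) (trans (cong (ℚ._* K) (trans (ℚP.*-comm e (toℚ s)) s*e≡1)) (ℚP.*-identityˡ K))
    eM≤K : (e ℚ.* M) ℚ.* (A ℚ.- B) ℚ.≤ K ℚ.* (A ℚ.- B)
    eM≤K = begin
      (e ℚ.* M) ℚ.* (A ℚ.- B)   ≡⟨ ℚP.*-comm (e ℚ.* M) (A ℚ.- B) ⟩
      (A ℚ.- B) ℚ.* (e ℚ.* M)   ≤⟨ *-monoˡ-≤-0≤ (ρ²B-B≥0 B 0≤B) (ℚP.≤-trans (*-monoˡ-≤-0≤ 0≤e M≤sK) (ℚP.≤-reflexive e*s*K≡K)) ⟩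
      (A ℚ.- B) ℚ.* K           ≡⟨ ℚP.*-comm (A ℚ.- B) K ⟩
      K ℚ.* (A ℚ.- B)           ∎

  coinTotal : ∀ {m} → Vec ℤ (suc m) → Fin (suc m) → ℤ → ℚ
  coinTotal {m} P i p = ∑[ v ∈ allVecs (suc m) ] coinSum ρ p (Nplus P v) (Nminus P v) (lookup v i)

  coinTotal-zero : ∀ {m} (P : Vec ℤ (suc m)) i →
    coinTotal P i (+ 0) ≡ (toℚ 2 ℚ.* toℚ (length (allVecs (suc m)))) ℚ.* ((1ℚ ℚ.- γ) ℚ.* ρ ^ℚ 0 ℚ.+ β)
  coinTotal-zero {m} P i = begin
    coinTotal P i (+ 0)                                  ≡⟨ ∑-cong (λ v → coinSum-zero ρ (Nplus P v) (Nminus P v) (lookup v i)) (allVecs (suc m)) ⟩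
    ∑[ v ∈ allVecs (suc m) ] (ρ ^ℚ 1 ℚ.+ (ρ ^ℚ 1 ℚ.+ 0ℚ)) ≡⟨ ∑-const _ (allVecs (suc m)) ⟩
    M ℚ.* (ρ ^ℚ 1 ℚ.+ (ρ ^ℚ 1 ℚ.+ 0ℚ))
      ≡⟨ solve 2 (λ mm x → mm :* ((con 1ℚ :+ x) :* con 1ℚ :+ ((con 1ℚ :+ x) :* con 1ℚ :+ con 0ℚ))
                        := (con (toℚ 2) :* mm) :* ((con 1ℚ :- x :* x :* con ℚ.½) :* con 1ℚ :+ (x :+ x :* x :* con ℚ.½))) refl M e ⟩
    (toℚ 2 ℚ.* M) ℚ.* ((1ℚ ℚ.- γ) ℚ.* ρ ^ℚ 0 ℚ.+ β)      ∎
    where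
    open ≡-Reasoning
    open ℚ-Solver.+-*-Solver
    M = toℚ (length (allVecs (suc m)))

  coinTotal-nonzero-≤ : ∀ {m} → 8 * suc m + 4 ≤ sq s → (P : Vec ℤ (suc m)) (i : Fin (suc m)) (y : ℕ) (p : ℤ) →
    ∣ p ∣ ≡ suc y → lookup P i ≡ p → p ≢ + 0 →
    coinTotal P i p ℚ.≤ (toℚ 2 ℚ.* toℚ (length (allVecs (suc m)))) ℚ.* ((1ℚ ℚ.- γ) ℚ.* ρ ^ℚ ∣ p ∣ ℚ.+ β)
  coinTotal-nonzero-≤ {m} 8n+4≤s² P i y p ∣p∣≡1+y P[i]≡p p≢0 = begin
    coinTotal P i p
      ≡⟨ ∑-cong (λ v → coinSum-nonzero ρ y p ∣p∣≡1+y (Nplus P v) (Nminus P v) (lookup v i)) (allVecs (suc m)) ⟩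
    ∑[ v ∈ allVecs (suc m) ] ((A ℚ.+ B) ℚ.- θ v ℚ.* (A ℚ.- B))
      ≡⟨ ∑-affine (A ℚ.+ B) (A ℚ.- B) θ (allVecs (suc m)) ⟩
    M ℚ.* (A ℚ.+ B) ℚ.- ∑ (allVecs (suc m)) θ ℚ.* (A ℚ.- B)
      ≡⟨ cong (λ z → M ℚ.* (A ℚ.+ B) ℚ.- z ℚ.* (A ℚ.- B)) (∑-agreement*majority P i p P[i]≡p p≢0) ⟩
    M ℚ.* (A ℚ.+ B) ℚ.- toℚ K ℚ.* (A ℚ.- B)
      ≤⟨ nonzero-drift M (toℚ K) B (0≤toℚ (length (allVecs (suc m)))) (0≤^ℚ 0≤ρ y) M≤sK ⟩
    (toℚ 2 ℚ.* M) ℚ.* ((1ℚ ℚ.- γ) ℚ.* ρ ^ℚ suc y ℚ.+ β)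
      ≡⟨ cong (λ k → (toℚ 2 ℚ.* M) ℚ.* ((1ℚ ℚ.- γ) ℚ.* ρ ^ℚ k ℚ.+ β)) (sym ∣p∣≡1+y) ⟩
    (toℚ 2 ℚ.* M) ℚ.* ((1ℚ ℚ.- γ) ℚ.* ρ ^ℚ ∣ p ∣ ℚ.+ β) ∎
    where
    open ℚP.≤-Reasoning
    M = toℚ (length (allVecs (suc m)))
    A = ρ ^ℚ (2 + y)
    B = ρ ^ℚ y
    θ = λ v → signℚ (agreement p (lookup v i)) ℚ.* majoritySign (Nplus P v) (Nminus P v)
    P′ = removeAt P i
    K = 2 ^ zeros P′ * pivotalMass (nonzeros P′)
    M≤sK : M ℚ.≤ toℚ s ℚ.* toℚ K
    M≤sK = ℚP.≤-trans (toℚ-mono-≤ (≤-trans (≤-reflexive (length-allVecs (suc m)))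
                                            (2^n≤s*pivotal s m (zeros P′) (nonzeros P′) (zeros+nonzeros P′) 8n+4≤s²)))
                      (ℚP.≤-reflexive (toℚ-* s K))

  drift : ∀ {m} → 8 * suc m + 4 ≤ sq s → (P : Vec ℤ (suc m)) (i : Fin (suc m)) →
    stepTotal (potential ρ i) P ℚ.≤ toℚ (length (allRounds (suc m))) ℚ.* ((1ℚ ℚ.- γ) ℚ.* potential ρ i P ℚ.+ β)
  drift {m} 8n+4≤s² P i = begin
    stepTotal (potential ρ i) P                                   ≡⟨ stepTotal-potential ρ i P ⟩
    coinTotal P i (lookup P i)                                    ≤⟨ coinTotal-≤ (lookup P i) refl ⟩
    (toℚ 2 ℚ.* M) ℚ.* ((1ℚ ℚ.- γ) ℚ.* potential ρ i P ℚ.+ β)      ≡⟨ cong (ℚ._* ((1ℚ ℚ.- γ) ℚ.* potential ρ i P ℚ.+ β)) #rounds ⟨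
    toℚ (length (allRounds (suc m))) ℚ.* ((1ℚ ℚ.- γ) ℚ.* potential ρ i P ℚ.+ β) ∎
    where
    open ℚP.≤-Reasoning
    M = toℚ (length (allVecs (suc m)))
    #rounds : toℚ (length (allRounds (suc m))) ≡ toℚ 2 ℚ.* M
    #rounds = trans (cong toℚ (trans (length-allRounds (suc m)) (cong (2 *_) (sym (length-allVecs (suc m))))))
                    (toℚ-* 2 (length (allVecs (suc m))))
    coinTotal-≤ : ∀ p → lookup P i ≡ p → coinTotal P i p ℚ.≤ (toℚ 2 ℚ.* M) ℚ.* ((1ℚ ℚ.- γ) ℚ.* ρ ^ℚ ∣ p ∣ ℚ.+ β)
    coinTotal-≤ (+ 0)      _      = ℚP.≤-reflexive (coinTotal-zero P i)
    coinTotal-≤ +[1+ y ] P[i]≡p = coinTotal-nonzero-≤ 8n+4≤s² P i y +[1+ y ] refl P[i]≡p (λ ())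
    coinTotal-≤ -[1+ y ] P[i]≡p = coinTotal-nonzero-≤ 8n+4≤s² P i y -[1+ y ] refl P[i]≡p (λ ())

module Potential (s′ : ℕ) where

  private
    instance
      s-pos : ℚ.Positive (toℚ (suc s′))
      s-pos = ℚ.positive (toℚ-mono-< {0} {suc s′} (s≤s z≤n))
      s-nonZero : ℚ.NonZero (toℚ (suc s′))
      s-nonZero = ℚP.pos⇒nonZero (toℚ (suc s′))

  e : ℚ
  e = ℚ.1/ toℚ (suc s′)

  0≤e : 0ℚ ℚ.≤ e
  0≤e = ℚP.<⇒≤ (ℚP.positive⁻¹ e {{ℚP.1/pos⇒pos (toℚ (suc s′))}})

  open Drift s′ e (ℚP.*-inverseʳ (toℚ (suc s′))) 0≤e public

  bernoulli : ∀ k → 1ℚ ℚ.+ toℚ k ℚ.* e ℚ.≤ ρ ^ℚ k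
  bernoulli zero    = ℚP.≤-reflexive (trans (cong (1ℚ ℚ.+_) (ℚP.*-zeroˡ e)) (ℚP.+-identityʳ 1ℚ))
  bernoulli (suc k) = begin
    1ℚ ℚ.+ (1ℚ ℚ.+ toℚ k) ℚ.* e                            ≤⟨ p≤p+q _ (0≤* (0≤toℚ k) (0≤* 0≤e 0≤e)) ⟩
    1ℚ ℚ.+ (1ℚ ℚ.+ toℚ k) ℚ.* e ℚ.+ toℚ k ℚ.* (e ℚ.* e)
      ≡⟨ solve 2 (λ a x → con 1ℚ :+ (con 1ℚ :+ a) :* x :+ a :* (x :* x) := (con 1ℚ :+ x) :* (con 1ℚ :+ a :* x)) refl (toℚ k) e ⟩
    ρ ℚ.* (1ℚ ℚ.+ toℚ k ℚ.* e)                             ≤⟨ *-monoˡ-≤-0≤ 0≤ρ (bernoulli k) ⟩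
    ρ ℚ.* ρ ^ℚ k                                           ∎
    where
    open ℚP.≤-Reasoning
    open ℚ-Solver.+-*-Solver

  2^j≤ρ^sj : ∀ j → toℚ (2 ^ j) ℚ.≤ ρ ^ℚ (s * j)
  2^j≤ρ^sj j = begin
    toℚ (2 ^ j)        ≡⟨ toℚ-^ 2 j ⟩
    toℚ 2 ^ℚ j         ≤⟨ ^ℚ-monoˡ-≤ (0≤toℚ 2) 2≤ρ^s j ⟩
    (ρ ^ℚ s) ^ℚ j      ≡⟨ ^ℚ-* ρ s j ⟨
    ρ ^ℚ (s * j)       ∎
    where
    open ℚP.≤-Reasoning
    2≤ρ^s : toℚ 2 ℚ.≤ ρ ^ℚ s
    2≤ρ^s = ℚP.≤-trans (ℚP.≤-reflexive (cong (1ℚ ℚ.+_) (sym (ℚP.*-inverseʳ (toℚ s))))) (bernoulli s)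

  ρ^-monoʳ-≤ : ∀ {a b} → a ≤ b → ρ ^ℚ a ℚ.≤ ρ ^ℚ b
  ρ^-monoʳ-≤ {zero}  {zero}  _         = ℚP.≤-refl
  ρ^-monoʳ-≤ {zero}  {suc b} _         = ℚP.≤-trans 1≤ρ
    (ℚP.≤-trans (ℚP.≤-reflexive (sym (ℚP.*-identityʳ ρ))) (*-monoˡ-≤-0≤ 0≤ρ (ρ^-monoʳ-≤ {0} {b} z≤n)))
    where 1≤ρ = p≤p+q 1ℚ 0≤e
  ρ^-monoʳ-≤ {suc a} {suc b} (s≤s a≤b) = *-monoˡ-≤-0≤ 0≤ρ (ρ^-monoʳ-≤ a≤b)

  e≤1 : e ℚ.≤ 1ℚ
  e≤1 = ℚP.≤-trans (p≤p+q e (0≤* (0≤toℚ s′) 0≤e))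
          (ℚP.≤-trans (ℚP.≤-reflexive (solve 2 (λ a x → x :+ a :* x := (con 1ℚ :+ a) :* x) refl (toℚ s′) e))
                      (ℚP.≤-reflexive (ℚP.*-inverseʳ (toℚ s))))
    where open ℚ-Solver.+-*-Solver

  0≤1-γ : 0ℚ ℚ.≤ 1ℚ ℚ.- γ
  0≤1-γ = p≤q⇒0≤q-p (begin
    e ℚ.* e ℚ.* ℚ.½     ≡⟨ ℚP.*-comm (e ℚ.* e) ℚ.½ ⟩
    ℚ.½ ℚ.* (e ℚ.* e)   ≤⟨ *-monoˡ-≤-0≤ (ℚP.<⇒≤ (ℚP.positive⁻¹ ℚ.½)) e²≤1 ⟩
    ℚ.½ ℚ.* 1ℚ          ≤⟨ toWitness {a? = ℚ.½ ℚ.* 1ℚ ℚP.≤? 1ℚ} tt ⟩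
    1ℚ                  ∎)
    where
    open ℚP.≤-Reasoning
    e²≤1 : e ℚ.* e ℚ.≤ 1ℚ
    e²≤1 = ℚP.≤-trans (*-monoˡ-≤-0≤ 0≤e e≤1) (ℚP.≤-trans (ℚP.≤-reflexive (ℚP.*-identityʳ e)) e≤1)

  -- The equilibrium level β / γ of the drift, which is 2s + 1.
  c : ℚ
  c = toℚ 2 ℚ.* toℚ s ℚ.+ 1ℚ

  β≤γc : β ℚ.≤ γ ℚ.* c
  β≤γc = ℚP.≤-reflexive (sym (begin
    γ ℚ.* c
      ≡⟨ solve 3 (λ x a h → x :* x :* h :* (con (toℚ 2) :* a :+ con 1ℚ) := (a :* x) :* x :* (h :* con (toℚ 2)) :+ x :* x :* h) refl e (toℚ s) ℚ.½ ⟩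
    (toℚ s ℚ.* e) ℚ.* e ℚ.* (ℚ.½ ℚ.* toℚ 2) ℚ.+ γ
      ≡⟨ cong (λ z → z ℚ.* e ℚ.* (ℚ.½ ℚ.* toℚ 2) ℚ.+ γ) (ℚP.*-inverseʳ (toℚ s)) ⟩
    1ℚ ℚ.* e ℚ.* (ℚ.½ ℚ.* toℚ 2) ℚ.+ γ
      ≡⟨ cong (ℚ._+ γ) (solve 1 (λ x → con 1ℚ :* x :* (con ℚ.½ :* con (toℚ 2)) := x) refl e) ⟩
    β ∎))
    where
    open ≡-Reasoning
    open ℚ-Solver.+-*-Solver

  runTotal-potential-≤ : ∀ {m} → 8 * suc m + 4 ≤ sq s → (i : Fin (suc m)) → ∀ T →
    runTotal T (potential ρ i) (V.replicate (suc m) (+ 0)) ℚ.≤ toℚ (Ω (suc m) T) ℚ.* toℚ (2 * s + 2)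
  runTotal-potential-≤ {m} 8n+4≤s² i T = begin
    runTotal T (potential ρ i) 0ⱽ
      ≤⟨ runTotal-≤-of-drift (potential ρ i) (λ Q → 0≤^ℚ 0≤ρ ∣ lookup Q i ∣) 0≤γ 0≤1-γ 0≤c β≤γc (λ Q → drift 8n+4≤s² Q i) T 0ⱽ ⟩
    toℚ (length (outcomes (suc m) T)) ℚ.* (ρ ^ℚ ∣ lookup 0ⱽ i ∣ ℚ.+ c)
      ≡⟨ cong₂ (λ l p → toℚ l ℚ.* (ρ ^ℚ ∣ p ∣ ℚ.+ c)) (length-outcomes (suc m) T) (VP.lookup-replicate i (+ 0)) ⟩
    toℚ (Ω (suc m) T) ℚ.* (1ℚ ℚ.+ c)
      ≡⟨ cong (toℚ (Ω (suc m) T) ℚ.*_) 1+c≡2s+2 ⟩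
    toℚ (Ω (suc m) T) ℚ.* toℚ (2 * s + 2) ∎
    where
    open ℚP.≤-Reasoning
    open ℚ-Solver.+-*-Solver
    0ⱽ = V.replicate (suc m) (+ 0)
    0≤c : 0ℚ ℚ.≤ c
    0≤c = ℚP.+-mono-≤ (0≤* (0≤toℚ 2) (0≤toℚ s)) (0≤toℚ 1)
    1+c≡2s+2 : 1ℚ ℚ.+ c ≡ toℚ (2 * s + 2)
    1+c≡2s+2 = begin-equality
      1ℚ ℚ.+ (toℚ 2 ℚ.* toℚ s ℚ.+ 1ℚ)   ≡⟨ solve 1 (λ a → con 1ℚ :+ (con (toℚ 2) :* a :+ con 1ℚ) := con (toℚ 2) :* a :+ con (toℚ 2)) refl (toℚ s) ⟩
      toℚ 2 ℚ.* toℚ s ℚ.+ toℚ 2         ≡⟨ cong (ℚ._+ toℚ 2) (toℚ-* 2 s) ⟨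
      toℚ (2 * s) ℚ.+ toℚ 2             ≡⟨ toℚ-+ (2 * s) 2 ⟨
      toℚ (2 * s + 2)                   ∎

  -- Markov's inequality for ρ ^ |P_T(i)|, using ρ ^ (s j) ≥ 2 ^ j.
  markov : ∀ {m} → 8 * suc m + 4 ≤ sq s → (i : Fin (suc m)) → ∀ T j (B : ℕ → Bool) → (∀ x → B x ≡ true → s * j ≤ x) →
    sumL (map (λ rs → b2n (B ∣ lookup (finalP (suc m) rs) i ∣)) (outcomes (suc m) T)) * 2 ^ j ≤ Ω (suc m) T * (2 * s + 2)
  markov {m} 8n+4≤s² i T j B B⇒sj≤ = toℚ-cancel-≤ (begin
    toℚ (#B * 2 ^ j)                                      ≡⟨ toℚ-* #B (2 ^ j) ⟩
    toℚ #B ℚ.* toℚ (2 ^ j)                                ≤⟨ *-monoˡ-≤-0≤ (0≤toℚ #B) (2^j≤ρ^sj j) ⟩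
    toℚ #B ℚ.* ρ ^ℚ (s * j)                               ≡⟨ ℚP.*-comm (toℚ #B) (ρ ^ℚ (s * j)) ⟩
    ρ ^ℚ (s * j) ℚ.* toℚ #B                               ≡⟨ cong (ρ ^ℚ (s * j) ℚ.*_) (∑-toℚ big O) ⟨
    ρ ^ℚ (s * j) ℚ.* ∑[ rs ∈ O ] toℚ (big rs)            ≡⟨ ∑-*ˡ (ρ ^ℚ (s * j)) (toℚ ∘ big) O ⟨
    ∑[ rs ∈ O ] (ρ ^ℚ (s * j) ℚ.* toℚ (big rs))          ≤⟨ ∑-mono-≤ (λ rs → indicator-≤ ∣ lookup (finalP (suc m) rs) i ∣) O ⟩
    runTotal T (potential ρ i) (V.replicate (suc m) (+ 0)) ≤⟨ runTotal-potential-≤ 8n+4≤s² i T ⟩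
    toℚ (Ω (suc m) T) ℚ.* toℚ (2 * s + 2)                 ≡⟨ toℚ-* (Ω (suc m) T) (2 * s + 2) ⟨
    toℚ (Ω (suc m) T * (2 * s + 2))                       ∎)
    where
    open ℚP.≤-Reasoning
    O = outcomes (suc m) T
    big = λ rs → b2n (B ∣ lookup (finalP (suc m) rs) i ∣)
    #B = sumL (map big O)
    indicator-≤ : ∀ x → ρ ^ℚ (s * j) ℚ.* toℚ (b2n (B x)) ℚ.≤ ρ ^ℚ x
    indicator-≤ x with B x in Bx
    ... | true  = ℚP.≤-trans (ℚP.≤-reflexive (trans (cong (ρ ^ℚ (s * j) ℚ.*_) (ℚP.+-identityʳ 1ℚ)) (ℚP.*-identityʳ (ρ ^ℚ (s * j)))))
                             (ρ^-monoʳ-≤ (B⇒sj≤ x Bx))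
    ... | false = ℚP.≤-trans (ℚP.≤-reflexive (ℚP.*-zeroʳ (ρ ^ℚ (s * j)))) (0≤^ℚ 0≤ρ x)

-- Union bound and tail sums

sumFin : ∀ {n} → (Fin n → ℕ) → ℕ
sumFin {zero}  f = 0
sumFin {suc n} f = f zero + sumFin (f ∘ suc)

sumFin-mono-≤ : ∀ {n} {f g : Fin n → ℕ} → (∀ i → f i ≤ g i) → sumFin f ≤ sumFin g
sumFin-mono-≤ {zero}  f≤g = z≤n
sumFin-mono-≤ {suc n} f≤g = +-mono-≤ (f≤g zero) (sumFin-mono-≤ (f≤g ∘ suc))

sumFin-const : ∀ n c → sumFin {n} (λ _ → c) ≡ n * c
sumFin-const zero    c = refl
sumFin-const (suc n) c = cong (_+_ c) (sumFin-const n c)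

sumFin-*ʳ : ∀ {n} (f : Fin n → ℕ) c → sumFin f * c ≡ sumFin (λ i → f i * c)
sumFin-*ʳ {zero}  f c = refl
sumFin-*ʳ {suc n} f c = trans (*-distribʳ-+ c (f zero) _) (cong (_+_ (f zero * c)) (sumFin-*ʳ (f ∘ suc) c))

module _ {A : Set} where

  sumL-mono-≤ : ∀ {f g : A → ℕ} → (∀ x → f x ≤ g x) → ∀ xs → sumL (map f xs) ≤ sumL (map g xs)
  sumL-mono-≤ f≤g []       = z≤n
  sumL-mono-≤ f≤g (x ∷ xs) = +-mono-≤ (f≤g x) (sumL-mono-≤ f≤g xs)

  sumL-+ : ∀ (f g : A → ℕ) xs → sumL (map (λ x → f x + g x) xs) ≡ sumL (map f xs) + sumL (map g xs)
  sumL-+ f g []       = refl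
  sumL-+ f g (x ∷ xs) rewrite sumL-+ f g xs =
    solve 4 (λ a b c d → a :+ b :+ (c :+ d) := a :+ c :+ (b :+ d)) refl (f x) (g x) (sumL (map f xs)) (sumL (map g xs))
    where open ℕ-Solver.+-*-Solver

  sumL-*ˡ : ∀ c (f : A → ℕ) xs → sumL (map (λ x → c * f x) xs) ≡ c * sumL (map f xs)
  sumL-*ˡ c f []       = sym (*-zeroʳ c)
  sumL-*ˡ c f (x ∷ xs) = trans (cong (_+_ (c * f x)) (sumL-*ˡ c f xs)) (sym (*-distribˡ-+ c (f x) _))

  sumL-const : ∀ c (xs : List A) → sumL (map (λ _ → c) xs) ≡ length xs * c
  sumL-const c []       = refl
  sumL-const c (x ∷ xs) = cong (_+_ c) (sumL-const c xs)

  sumL-sumFin : ∀ {n} (F : A → Fin n → ℕ) xs → sumL (map (λ x → sumFin (F x)) xs) ≡ sumFin (λ i → sumL (map (λ x → F x i) xs))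
  sumL-sumFin {zero}  F xs = trans (sumL-const 0 xs) (*-zeroʳ (length xs))
  sumL-sumFin {suc n} F xs = trans (sumL-+ (λ x → F x zero) (λ x → sumFin (F x ∘ suc)) xs)
    (cong (_+_ (sumL (map (λ x → F x zero) xs))) (sumL-sumFin (λ x i → F x (suc i)) xs))

sumL-outcomes-const : ∀ n T c → sumL (map (λ _ → c) (outcomes n T)) ≡ Ω n T * c
sumL-outcomes-const n T c = trans (sumL-const c (outcomes n T)) (cong (_* c) (length-outcomes n T))

sumL-outcomes-mono-≤ : ∀ n T (f g : List (Vec Bool n × Bool) → ℕ) → (∀ rs → length rs ≡ T → f rs ≤ g rs) →
  sumL (map f (outcomes n T)) ≤ sumL (map g (outcomes n T))
sumL-outcomes-mono-≤ n zero    f g f≤g = +-monoˡ-≤ 0 (f≤g [] refl)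
sumL-outcomes-mono-≤ n (suc T) f g f≤g = go (allRounds n)
  where
  go : ∀ rounds → sumL (map f (concatMap (λ r → map (r ∷_) (outcomes n T)) rounds))
                  ≤ sumL (map g (concatMap (λ r → map (r ∷_) (outcomes n T)) rounds))
  go []       = z≤n
  go (r ∷ rs) = begin
    sumL (map f (map (r ∷_) (outcomes n T) ++ rest))             ≡⟨ cong sumL (map-++ f (map (r ∷_) (outcomes n T)) rest) ⟩
    sumL (map f (map (r ∷_) (outcomes n T)) ++ map f rest)       ≡⟨ sum-++ (map f (map (r ∷_) (outcomes n T))) (map f rest) ⟩
    sumL (map f (map (r ∷_) (outcomes n T))) + sumL (map f rest)
      ≤⟨ +-mono-≤ (≤-trans (≤-reflexive (cong sumL (sym (map-∘ (outcomes n T)))))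
                   (≤-trans (sumL-outcomes-mono-≤ n T (f ∘ (r ∷_)) (g ∘ (r ∷_)) (λ rs′ e → f≤g (r ∷ rs′) (cong suc e)))
                            (≤-reflexive (cong sumL (map-∘ (outcomes n T))))))
                  (go rs) ⟩
    sumL (map g (map (r ∷_) (outcomes n T))) + sumL (map g rest) ≡⟨ sum-++ (map g (map (r ∷_) (outcomes n T))) (map g rest) ⟨
    sumL (map g (map (r ∷_) (outcomes n T)) ++ map g rest)       ≡⟨ cong sumL (map-++ g (map (r ∷_) (outcomes n T)) rest) ⟨
    sumL (map g (map (r ∷_) (outcomes n T) ++ rest))             ∎
    where
    open ≤-Reasoning
    rest = concatMap (λ r → map (r ∷_) (outcomes n T)) rs

b2n≤1 : ∀ a → b2n a ≤ 1
b2n≤1 true  = ≤-refl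
b2n≤1 false = z≤n

b2n-∨ : ∀ a b → b2n (a ∨ b) ≤ b2n a + b2n b
b2n-∨ true  b = s≤s z≤n
b2n-∨ false b = ≤-refl

≤ᵇ≡true⇒≤ : ∀ {a b} → (a ≤ᵇ b) ≡ true → a ≤ b
≤ᵇ≡true⇒≤ {a} {b} eq = ≤ᵇ⇒≤ a b (subst T (sym eq) tt)

≤⇒≤ᵇ≡true : ∀ {a b} → a ≤ b → (a ≤ᵇ b) ≡ true
≤⇒≤ᵇ≡true {a} {b} a≤b with a ≤ᵇ b | ≤⇒≤ᵇ a≤b
... | true | _ = refl

b2n-≤ᵇ-⊔ : ∀ L x y → b2n (L ≤ᵇ x ⊔ y) ≤ b2n (L ≤ᵇ x) + b2n (L ≤ᵇ y)
b2n-≤ᵇ-⊔ L x y with L ≤ᵇ x ⊔ y in eq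
... | false = z≤n
... | true with ⊔-sel x y
...   | inj₁ x⊔y≡x rewrite ≤⇒≤ᵇ≡true (subst (L ≤_) x⊔y≡x (≤ᵇ≡true⇒≤ eq)) = s≤s z≤n
...   | inj₂ x⊔y≡y rewrite ≤⇒≤ᵇ≡true (subst (L ≤_) x⊔y≡y (≤ᵇ≡true⇒≤ eq)) = ≤-trans (s≤s z≤n) (≤-reflexive (+-comm 1 (b2n (L ≤ᵇ x))))

maxAbs : ∀ {n} → Vec ℤ n → ℕ
maxAbs P = foldr′ (λ p m → ∣ p ∣ ⊔ m) 0 P

maxAbs-≤ : ∀ {n} (P : Vec ℤ n) c → (∀ i → ∣ lookup P i ∣ ≤ c) → maxAbs P ≤ c
maxAbs-≤ []      c h = z≤n
maxAbs-≤ (p ∷ P) c h = ⊔-lub (h zero) (maxAbs-≤ P c (h ∘ suc))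

b2n-maxAbs-≤ : ∀ {n} L (P : Vec ℤ n) → b2n (suc L ≤ᵇ maxAbs P) ≤ sumFin (λ i → b2n (suc L ≤ᵇ ∣ lookup P i ∣))
b2n-maxAbs-≤ L []      = z≤n
b2n-maxAbs-≤ L (p ∷ P) = ≤-trans (b2n-≤ᵇ-⊔ (suc L) ∣ p ∣ _) (+-monoʳ-≤ (b2n (suc L ≤ᵇ ∣ p ∣)) (b2n-maxAbs-≤ L P))

b2n-any-≤ : ∀ {n} (B : ℕ → Bool) (P : Vec ℤ n) → b2n (foldr′ (λ p acc → B ∣ p ∣ ∨ acc) false P) ≤ sumFin (λ i → b2n (B ∣ lookup P i ∣))
b2n-any-≤ B []      = z≤n
b2n-any-≤ B (p ∷ P) = ≤-trans (b2n-∨ (B ∣ p ∣) _) (+-monoʳ-≤ (b2n (B ∣ p ∣)) (b2n-any-≤ B P))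

∣step∣-≤ : ∀ {n} (P : Vec ℤ n) r i → ∣ lookup (step P r) i ∣ ≤ ∣ lookup P i ∣ + 1
∣step∣-≤ P (v , c) i = begin
  ∣ lookup (step P (v , c)) i ∣                         ≡⟨ cong ∣_∣ (VP.lookup-zipWith (λ p b → p ℤ.+ chooseX P v c ℤ.* sgn b) i P v) ⟩
  ∣ lookup P i ℤ.+ chooseX P v c ℤ.* sgn (lookup v i) ∣ ≤⟨ ℤP.∣i+j∣≤∣i∣+∣j∣ (lookup P i) _ ⟩
  ∣ lookup P i ∣ + ∣ chooseX P v c ℤ.* sgn (lookup v i) ∣ ≡⟨ cong (_+_ (∣ lookup P i ∣)) (trans (ℤP.abs-* (chooseX P v c) _) (cong₂ _*_ ∣chooseX∣ (∣sgn∣ (lookup v i)))) ⟩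
  ∣ lookup P i ∣ + 1                                    ∎
  where
  open ≤-Reasoning
  ∣sgn∣ : ∀ b → ∣ sgn b ∣ ≡ 1
  ∣sgn∣ true  = refl
  ∣sgn∣ false = refl
  ∣chooseX∣ : ∣ chooseX P v c ∣ ≡ 1
  ∣chooseX∣ with Nminus P v <ᵇ Nplus P v | Nplus P v <ᵇ Nminus P v
  ... | true  | _     = refl
  ... | false | true  = refl
  ... | false | false = ∣sgn∣ c

∣run∣-≤ : ∀ {n} (P : Vec ℤ n) rs i → ∣ lookup (run P rs) i ∣ ≤ ∣ lookup P i ∣ + length rs
∣run∣-≤ P []       i = m≤m+n _ 0
∣run∣-≤ P (r ∷ rs) i = ≤-trans (∣run∣-≤ (step P r) rs i)
  (≤-trans (+-monoˡ-≤ (length rs) (∣step∣-≤ P r i)) (≤-reflexive (+-assoc ∣ lookup P i ∣ 1 (length rs))))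

Vinf≤length : ∀ n rs → Vinf n rs ≤ length rs
Vinf≤length n rs = maxAbs-≤ (finalP n rs) (length rs) (λ i → ≤-trans (∣run∣-≤ (V.replicate n (+ 0)) rs i)
  (≤-reflexive (cong (λ z → ∣ z ∣ + length rs) (VP.lookup-replicate i (+ 0)))))

module Bounds (s′ : ℕ) where
  open Potential s′ using (s; markov)

  A : ℕ
  A = 2 * s + 2

  unionBound : ∀ m T j (B : ℕ → Bool) → 8 * suc m + 4 ≤ sq s → (∀ x → B x ≡ true → s * j ≤ x) →
    sumL (map (λ rs → sumFin (λ i → b2n (B ∣ lookup (finalP (suc m) rs) i ∣))) (outcomes (suc m) T)) * 2 ^ j
      ≤ suc m * (Ω (suc m) T * A)
  unionBound m T j B 8n+4≤s² B⇒sj≤ = begin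
    sumL (map (λ rs → sumFin (F rs)) O) * 2 ^ j      ≡⟨ cong (_* 2 ^ j) (sumL-sumFin F O) ⟩
    sumFin (λ i → sumL (map (λ rs → F rs i) O)) * 2 ^ j ≡⟨ sumFin-*ʳ (λ i → sumL (map (λ rs → F rs i) O)) (2 ^ j) ⟩
    sumFin (λ i → sumL (map (λ rs → F rs i) O) * 2 ^ j) ≤⟨ sumFin-mono-≤ (λ i → markov 8n+4≤s² i T j B B⇒sj≤) ⟩
    sumFin {suc m} (λ _ → Ω (suc m) T * A)            ≡⟨ sumFin-const (suc m) _ ⟩
    suc m * (Ω (suc m) T * A)                         ∎
    where
    open ≤-Reasoning
    O = outcomes (suc m) T
    F = λ rs i → b2n (B ∣ lookup (finalP (suc m) rs) i ∣)

  countBig-2^j-≤ : ∀ m T k j → 8 * suc m + 4 ≤ sq s → (∀ x → k * k * suc m ≤ x * x → s * j ≤ x) →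
    countBig (suc m) T k * 2 ^ j ≤ suc m * (Ω (suc m) T * A)
  countBig-2^j-≤ m T k j 8n+4≤s² ≥k√n⇒≥sj = ≤-trans
    (*-monoˡ-≤ (2 ^ j) (sumL-mono-≤ (λ rs → b2n-any-≤ B (finalP (suc m) rs)) (outcomes (suc m) T)))
    (unionBound m T j B 8n+4≤s² (λ x Bx → ≥k√n⇒≥sj x (≤ᵇ≡true⇒≤ Bx)))
    where
    B : ℕ → Bool
    B x = k * k * suc m ≤ᵇ x * x

  exceedCount : ℕ → ℕ → ℕ → ℕ
  exceedCount m T j = sumL (map (λ rs → b2n (s * j ≤ᵇ Vinf (suc m) rs)) (outcomes (suc m) T))

  exceedCount-2^j-≤ : ∀ m T → 8 * suc m + 4 ≤ sq s → ∀ j → 1 ≤ j → exceedCount m T j * 2 ^ j ≤ suc m * (Ω (suc m) T * A)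
  exceedCount-2^j-≤ m T 8n+4≤s² (suc j) _ = ≤-trans
    (*-monoˡ-≤ (2 ^ suc j) (sumL-mono-≤ (λ rs → b2n-maxAbs-≤ (j + s′ * suc j) (finalP (suc m) rs)) (outcomes (suc m) T)))
    (unionBound m T (suc j) (λ x → s * suc j ≤ᵇ x) 8n+4≤s² (λ x → ≤ᵇ≡true⇒≤))

thresholdCount : ℕ → ℕ → ℕ → ℕ → ℕ
thresholdCount s a zero    V = 0
thresholdCount s a (suc M) V = b2n (s * a ≤ᵇ V) + thresholdCount s (suc a) M V

<-thresholdCount : ∀ s M a V → V < s * (a + M) → V < s * a + s * thresholdCount s a M V
<-thresholdCount s zero    a V V<s[a+0] = subst (V <_) (*-distribˡ-+ s a 0) V<s[a+0]
<-thresholdCount s (suc M) a V V<s[a+1+M] with s * a ≤ᵇ V in sa≤V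
... | true  = subst (V <_) (solve 3 (λ s a c → s :* (con 1 :+ a) :+ s :* c := s :* a :+ s :* (con 1 :+ c)) refl s a (thresholdCount s (suc a) M V))
                (<-thresholdCount s M (suc a) V (subst (λ z → V < s * z) (+-suc a M) V<s[a+1+M]))
  where open ℕ-Solver.+-*-Solver
... | false = ≤-trans (≰⇒> (λ sa≤V′ → true≢false (trans (sym (≤⇒≤ᵇ≡true sa≤V′)) sa≤V))) (m≤m+n (s * a) _)
  where
  true≢false : true ≢ false
  true≢false ()

rangeSum : (ℕ → ℕ) → ℕ → ℕ → ℕ
rangeSum f a zero    = 0
rangeSum f a (suc M) = f a + rangeSum f (suc a) M

sumL-thresholdCount : ∀ {X : Set} s (V : X → ℕ) xs M a →
  sumL (map (λ x → thresholdCount s a M (V x)) xs) ≡ rangeSum (λ j → sumL (map (λ x → b2n (s * j ≤ᵇ V x)) xs)) a M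
sumL-thresholdCount s V xs zero    a = trans (sumL-const 0 xs) (*-zeroʳ (length xs))
sumL-thresholdCount s V xs (suc M) a = trans (sumL-+ (λ x → b2n (s * a ≤ᵇ V x)) (λ x → thresholdCount s (suc a) M (V x)) xs)
  (cong (_+_ (sumL (map (λ x → b2n (s * a ≤ᵇ V x)) xs))) (sumL-thresholdCount s V xs M (suc a)))

rangeSum-geometric : ∀ (f : ℕ → ℕ) X → (∀ j → 1 ≤ j → f j * 2 ^ j ≤ X) → ∀ M a → 1 ≤ a → 2 ^ a * rangeSum f a M ≤ 2 * X
rangeSum-geometric f X f2^j≤X zero    a _   = subst (_≤ 2 * X) (sym (*-zeroʳ (2 ^ a))) z≤n
rangeSum-geometric f X f2^j≤X (suc M) a 1≤a = begin
  2 ^ a * (f a + rangeSum f (suc a) M)                  ≡⟨ *-distribˡ-+ (2 ^ a) (f a) _ ⟩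
  2 ^ a * f a + 2 ^ a * rangeSum f (suc a) M            ≤⟨ +-mono-≤ (subst (_≤ X) (*-comm (f a) (2 ^ a)) (f2^j≤X a 1≤a)) tail≤X ⟩
  X + X                                                 ≡⟨ cong (_+_ X) (+-identityʳ X) ⟨
  2 * X                                                 ∎
  where
  open ≤-Reasoning
  tail≤X : 2 ^ a * rangeSum f (suc a) M ≤ X
  tail≤X = *-cancelˡ-≤ 2 (≤-trans (≤-reflexive (sym (*-assoc 2 (2 ^ a) _))) (rangeSum-geometric f X f2^j≤X M (suc a) (s≤s z≤n)))

module Expectation (s′ : ℕ) where
  open Potential s′ using (s)
  open Bounds s′

  -- V ≤ s a + s #{ j ≥ a : V ≥ s j }, and the counts decay geometrically in j beyond a.
  sumV-≤ : ∀ m T a → 8 * suc m + 4 ≤ sq s → 1 ≤ a → 2 * (suc m * A) ≤ 2 ^ a → sumV (suc m) T ≤ s * (Ω (suc m) T * (a + 1))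
  sumV-≤ m T a 8n+4≤s² 1≤a 2nA≤2^a = begin
    sumV (suc m) T                                                     ≤⟨ sumL-outcomes-mono-≤ (suc m) T V (λ rs → s * a + s * cnt rs) V≤ ⟩
    sumL (map (λ rs → s * a + s * cnt rs) O)                           ≡⟨ sumL-+ (λ _ → s * a) (λ rs → s * cnt rs) O ⟩
    sumL (map (λ _ → s * a) O) + sumL (map (λ rs → s * cnt rs) O)      ≡⟨ cong₂ _+_ (sumL-outcomes-const (suc m) T (s * a))
                                                                             (trans (sumL-*ˡ s cnt O) (cong (s *_) (sumL-thresholdCount s V O T a))) ⟩
    W * (s * a) + s * rangeSum (exceedCount m T) a T                   ≤⟨ +-monoʳ-≤ (W * (s * a)) (*-monoʳ-≤ s tail≤W) ⟩
    W * (s * a) + s * W                                                ≡⟨ solve 3 (λ w s a → w :* (s :* a) :+ s :* w := s :* (w :* (a :+ con 1))) refl W s a ⟩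
    s * (W * (a + 1))                                                  ∎
    where
    open ≤-Reasoning
    open ℕ-Solver.+-*-Solver
    O = outcomes (suc m) T
    W = Ω (suc m) T
    V = Vinf (suc m)
    cnt = λ rs → thresholdCount s a T (V rs)
    V≤ : ∀ rs → length rs ≡ T → V rs ≤ s * a + s * cnt rs
    V≤ rs ∣rs∣≡T = <⇒≤ (<-thresholdCount s T a (V rs) (begin-strict
      V rs           ≤⟨ Vinf≤length (suc m) rs ⟩
      length rs      ≡⟨ ∣rs∣≡T ⟩
      T              <⟨ +-monoˡ-≤ T 1≤a ⟩
      a + T          ≤⟨ m≤m+n (a + T) (s′ * (a + T)) ⟩
      s * (a + T)    ∎))
    tail≤W : rangeSum (exceedCount m T) a T ≤ W
    tail≤W = *-cancelˡ-≤ (2 ^ a) {{m^n≢0 2 a}} (begin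
      2 ^ a * rangeSum (exceedCount m T) a T   ≤⟨ rangeSum-geometric (exceedCount m T) (suc m * (W * A)) (exceedCount-2^j-≤ m T 8n+4≤s²) T a 1≤a ⟩
      2 * (suc m * (W * A))                    ≡⟨ solve 3 (λ n w c → con 2 :* (n :* (w :* c)) := (con 2 :* (n :* c)) :* w) refl (suc m) W A ⟩
      (2 * (suc m * A)) * W                    ≤⟨ *-monoˡ-≤ W 2nA≤2^a ⟩
      2 ^ a * W                                ∎)

-- Choice of the scale and the final estimates

square-between : ∀ M → Σ[ s′ ∈ ℕ ] (suc M ≤ sq (suc s′) × sq (suc s′) ≤ 4 * suc M)
square-between zero = 0 , ≤-refl , s≤s z≤n
square-between (suc M) with square-between M
... | s′ , lo , hi with suc (suc M) ≤? sq (suc s′)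
...   | yes 2+M≤s² = s′ , 2+M≤s² , ≤-trans hi (*-monoʳ-≤ 4 (n≤1+n (suc M)))
...   | no  2+M≰s² = s′ + suc s′ , ≤-trans 2+M≤4+4M (≤-reflexive (sym [2s]²≡4s²)) , ≤-trans (≤-reflexive [2s]²≡4s²) (*-monoʳ-≤ 4 (n≤1+n (suc M)))
  where
  open ℕ-Solver.+-*-Solver
  s²≡1+M : sq (suc s′) ≡ suc M
  s²≡1+M = ≤-antisym (≤-pred (≰⇒> 2+M≰s²)) lo
  [2s]²≡4s² : sq (suc (s′ + suc s′)) ≡ 4 * suc M
  [2s]²≡4s² = trans (solve 1 (λ x → (con 1 :+ (x :+ (con 1 :+ x))) :* (con 1 :+ (x :+ (con 1 :+ x))) := con 4 :* ((con 1 :+ x) :* (con 1 :+ x))) refl s′)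
                    (cong (4 *_) s²≡1+M)
  2+M≤4+4M : suc (suc M) ≤ 4 * suc M
  2+M≤4+4M = ≤-trans (≤-reflexive (+-comm 1 (suc M))) (+-monoʳ-≤ (suc M) (s≤s z≤n))

^-distribʳ-* : ∀ a b k → (a * b) ^ k ≡ a ^ k * b ^ k
^-distribʳ-* a b zero    = refl
^-distribʳ-* a b (suc k) = trans (cong (a * b *_) (^-distribʳ-* a b k))
  (solve 4 (λ a b x y → (a :* b) :* (x :* y) := (a :* x) :* (b :* y)) refl a b (a ^ k) (b ^ k))
  where open ℕ-Solver.+-*-Solver

-- Since (441/400)^7 < 2, the ratio (441/400)^k / 2^⌊k/7⌋ stays below (441/400)^6 < 361/192.
tail-constant : ∀ j r → r < 7 → 192 * 441 ^ (r + j * 7) ≤ 361 * (400 ^ (r + j * 7) * 2 ^ j)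
tail-constant zero 0 _ = ≤ᵇ⇒≤ _ _ tt
tail-constant zero 1 _ = ≤ᵇ⇒≤ _ _ tt
tail-constant zero 2 _ = ≤ᵇ⇒≤ _ _ tt
tail-constant zero 3 _ = ≤ᵇ⇒≤ _ _ tt
tail-constant zero 4 _ = ≤ᵇ⇒≤ _ _ tt
tail-constant zero 5 _ = ≤ᵇ⇒≤ _ _ tt
tail-constant zero 6 _ = ≤ᵇ⇒≤ _ _ tt
tail-constant zero (suc (suc (suc (suc (suc (suc (suc _))))))) (s≤s (s≤s (s≤s (s≤s (s≤s (s≤s (s≤s ())))))))
tail-constant (suc j) r r<7 =
  subst₂ (λ u v → 192 * u ≤ 361 * (v * 2 ^ suc j)) (sym (split 441)) (sym (split 400))
         (scale {441 ^ 7} {400 ^ 7} {441 ^ (r + j * 7)} {400 ^ (r + j * 7)} {2 ^ j} (≤ᵇ⇒≤ (441 ^ 7) (2 * 400 ^ 7) tt) (tail-constant j r r<7))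
  where
  open ℕ-Solver.+-*-Solver
  split : ∀ a → a ^ (r + (7 + j * 7)) ≡ a ^ 7 * a ^ (r + j * 7)
  split a = trans (cong (a ^_) (solve 2 (λ r j → r :+ (con 7 :+ j :* con 7) := con 7 :+ (r :+ j :* con 7)) refl r j))
                  (^-distribˡ-+-* a 7 (r + j * 7))
  scale : ∀ {x y a b z} → x ≤ 2 * y → 192 * a ≤ 361 * (b * z) → 192 * (x * a) ≤ 361 * ((y * b) * (2 * z))
  scale {x} {y} {a} {b} {z} x≤2y ih = begin
    192 * (x * a)            ≡⟨ solve 2 (λ x a → con 192 :* (x :* a) := x :* (con 192 :* a)) refl x a ⟩
    x * (192 * a)            ≤⟨ *-mono-≤ x≤2y ih ⟩
    2 * y * (361 * (b * z))  ≡⟨ solve 3 (λ y b z → con 2 :* y :* (con 361 :* (b :* z)) := con 361 :* ((y :* b) :* (con 2 :* z))) refl y b z ⟩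
    361 * ((y * b) * (2 * z)) ∎
    where open ≤-Reasoning

tail-arithmetic : ∀ n w c A k → c ≤ w → c * 2 ^ (k / 7) ≤ n * (w * A) → A ≤ 192 * n →
                  c * 21 ^ k ≤ 19 * n * 20 ^ k * w
tail-arithmetic n w c A k c≤w c2^j≤nwA A≤192n = sq-cancel-≤ (*-cancelʳ-≤ _ _ (2 ^ j) {{m^n≢0 2 j}} (begin
  sq (c * 21 ^ k) * 2 ^ j                   ≡⟨ solve 3 (λ c x y → ((c :* x) :* (c :* x)) :* y := c :* (c :* y) :* (x :* x)) refl c (21 ^ k) (2 ^ j) ⟩
  c * (c * 2 ^ j) * sq (21 ^ k)             ≡⟨ cong (c * (c * 2 ^ j) *_) (^-distribʳ-* 21 21 k) ⟨
  c * (c * 2 ^ j) * 441 ^ k                 ≤⟨ *-monoˡ-≤ (441 ^ k) (*-mono-≤ c≤w (≤-trans c2^j≤nwA (*-monoʳ-≤ n (*-monoʳ-≤ w A≤192n)))) ⟩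
  w * (n * (w * (192 * n))) * 441 ^ k       ≡⟨ solve 3 (λ w n x → w :* (n :* (w :* (con 192 :* n))) :* x := (n :* n :* (w :* w)) :* (con 192 :* x)) refl w n (441 ^ k) ⟩
  (n * n * (w * w)) * (192 * 441 ^ k)       ≤⟨ *-monoʳ-≤ (n * n * (w * w)) (subst (λ i → 192 * 441 ^ i ≤ 361 * (400 ^ i * 2 ^ j)) (sym k≡r+7j) (tail-constant j (k % 7) (m%n<n k 7))) ⟩
  (n * n * (w * w)) * (361 * (400 ^ k * 2 ^ j))
    ≡⟨ cong (λ x → (n * n * (w * w)) * (361 * (x * 2 ^ j))) (^-distribʳ-* 20 20 k) ⟩
  (n * n * (w * w)) * (361 * (sq (20 ^ k) * 2 ^ j))
    ≡⟨ solve 4 (λ n w x y → (n :* n :* (w :* w)) :* (con 361 :* ((x :* x) :* y)) := ((con 19 :* n :* x :* w) :* (con 19 :* n :* x :* w)) :* y) refl n w (20 ^ k) (2 ^ j) ⟩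
  sq (19 * n * 20 ^ k * w) * 2 ^ j          ∎))
  where
  open ≤-Reasoning
  open ℕ-Solver.+-*-Solver
  j = k / 7
  k≡r+7j : k ≡ k % 7 + j * 7
  k≡r+7j = m≡m%n+[m/n]*n k 7

-- The scale s ≈ √(8n) of the potential ρ = 1 + 1/s.
scale-exists : ∀ m → Σ[ s′ ∈ ℕ ] (8 * suc m + 4 ≤ sq (suc s′) × sq (suc s′) ≤ 48 * suc m)
scale-exists m with square-between (8 * suc m + 3)
... | s′ , lo , hi = s′ , subst (_≤ sq (suc s′)) (sym (+-suc (8 * suc m) 3)) lo
                         , ≤-trans hi (≤-trans (m≤m+n _ (16 * m)) (≤-reflexive (solve 1 (λ m → con 4 :* (con 1 :+ (con 8 :* (con 1 :+ m) :+ con 3)) :+ con 16 :* m := con 48 :* (con 1 :+ m)) refl m)))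
  where open ℕ-Solver.+-*-Solver

countBig-zero : ∀ T k → countBig 0 T k ≡ 0
countBig-zero T k = trans (cong sumL (map-cong (λ rs → noCoordinate (finalP 0 rs)) (outcomes 0 T)))
                          (trans (sumL-const 0 (outcomes 0 T)) (*-zeroʳ (length (outcomes 0 T))))
  where
  noCoordinate : (P : Vec ℤ 0) → b2n (foldr′ (λ p acc → (k * k * 0 ≤ᵇ ∣ p ∣ * ∣ p ∣) ∨ acc) false P) ≡ 0
  noCoordinate [] = refl

countBig-tail-at-scale : ∀ s′ m T k → 8 * suc m + 4 ≤ sq (suc s′) → sq (suc s′) ≤ 48 * suc m →
  countBig (suc m) T k * 21 ^ k ≤ 19 * suc m * 20 ^ k * Ω (suc m) T
countBig-tail-at-scale s′ m T k 8n+4≤s² s²≤ = tail-arithmetic (suc m) (Ω (suc m) T) (countBig (suc m) T k) A k countBig≤Ω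
      (countBig-2^j-≤ m T k (k / 7) 8n+4≤s² ≥k√n⇒≥sj) A≤192n
  where
  open Bounds s′
  open Potential s′ using (s)
  j = k / 7
  countBig≤Ω : countBig (suc m) T k ≤ Ω (suc m) T
  countBig≤Ω = ≤-trans (sumL-mono-≤ (λ rs → b2n≤1 (someBig (suc m) k rs)) (outcomes (suc m) T))
                       (≤-reflexive (trans (sumL-outcomes-const (suc m) T 1) (*-identityʳ (Ω (suc m) T))))
  s≤48n : s ≤ 48 * suc m
  s≤48n = ≤-trans (m≤m*n s s) s²≤
  A≤192n : A ≤ 192 * suc m
  A≤192n = ≤-trans (+-monoʳ-≤ (2 * s) (*-monoʳ-≤ 2 (s≤s (z≤n {s′}))))
             (≤-trans (≤-reflexive (solve 1 (λ a → con 2 :* a :+ con 2 :* a := con 4 :* a) refl s))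
                      (≤-trans (*-monoʳ-≤ 4 s≤48n) (≤-reflexive (sym (*-assoc 4 48 (suc m))))))
    where open ℕ-Solver.+-*-Solver
  ≥k√n⇒≥sj : ∀ x → k * k * suc m ≤ x * x → s * j ≤ x
  ≥k√n⇒≥sj x k²n≤x² = sq-cancel-≤ (begin
    sq (s * j)                  ≡⟨ solve 2 (λ a b → (a :* b) :* (a :* b) := (a :* a) :* (b :* b)) refl s j ⟩
    sq s * sq j                 ≤⟨ *-monoˡ-≤ (sq j) (≤-trans s²≤ (*-monoˡ-≤ (suc m) (≤ᵇ⇒≤ 48 49 tt))) ⟩
    49 * suc m * sq j           ≡⟨ solve 2 (λ n b → (con 49 :* n) :* (b :* b) := ((con 7 :* b) :* (con 7 :* b)) :* n) refl (suc m) j ⟩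
    sq (7 * j) * suc m          ≤⟨ *-monoˡ-≤ (suc m) (sq-mono-≤ 7j≤k) ⟩
    k * k * suc m               ≤⟨ k²n≤x² ⟩
    x * x                       ∎)
    where
    open ≤-Reasoning
    open ℕ-Solver.+-*-Solver
    7j≤k : 7 * j ≤ k
    7j≤k = subst (_≤ k) (*-comm j 7) (m/n*n≤m k 7)

countBig-tail : ∀ n T k → countBig n T k * 21 ^ k ≤ 19 * n * 20 ^ k * Ω n T
countBig-tail zero    T k = subst (λ c → c * 21 ^ k ≤ 0) (sym (countBig-zero T k)) z≤n
countBig-tail (suc m) T k = let s′ , 8n+4≤s² , s²≤48n = scale-exists m in countBig-tail-at-scale s′ m T k 8n+4≤s² s²≤48n

1≤⌊log₂⌋ : ∀ n → 2 ≤ n → 1 ≤ ⌊log₂ n ⌋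
1≤⌊log₂⌋ n 2≤n = subst (_≤ ⌊log₂ n ⌋) (⌊log₂[2^n]⌋≡n 1) (⌊log₂⌋-mono-≤ 2≤n)

<2^[1+⌊log₂⌋] : ∀ n → n < 2 ^ suc ⌊log₂ n ⌋
<2^[1+⌊log₂⌋] n with 2 ^ suc ⌊log₂ n ⌋ ≤? n
... | no  2^[1+L]≰n = ≰⇒> 2^[1+L]≰n
... | yes 2^[1+L]≤n = ⊥-elim (<-irrefl refl (≤-trans (≤-reflexive (sym (⌊log₂[2^n]⌋≡n (suc ⌊log₂ n ⌋)))) (⌊log₂⌋-mono-≤ 2^[1+L]≤n)))

sumV-at-scale : ∀ s′ m T → 8 * suc m + 4 ≤ sq (suc s′) → sq (suc s′) ≤ 48 * suc m → 1 ≤ ⌊log₂ (suc m) ⌋ →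
  sq (sumV (suc m) T) ≤ 97 * 97 * suc m * sq ⌊log₂ (suc m) ⌋ * sq (Ω (suc m) T)
sumV-at-scale s′ m T 8n+4≤s² s²≤48n 1≤L = begin
  sq (sumV n T)                          ≤⟨ sq-mono-≤ (sumV-≤ m T a 8n+4≤s² (≤-trans 1≤L (≤-trans (m≤m+n L L) (m≤m+n (L + L) 11))) 2nA≤2^a) ⟩
  sq (s * (W * (a + 1)))                 ≡⟨ solve 3 (λ s w b → (s :* (w :* b)) :* (s :* (w :* b)) := (s :* s) :* (b :* b) :* (w :* w)) refl s W (a + 1) ⟩
  sq s * sq (a + 1) * sq W               ≤⟨ *-monoˡ-≤ (sq W) (*-mono-≤ s²≤48n (sq-mono-≤ a+1≤14L)) ⟩
  48 * n * sq (14 * L) * sq W            ≡⟨ solve 3 (λ n l w → con 48 :* n :* ((con 14 :* l) :* (con 14 :* l)) :* w := con 9408 :* n :* (l :* l) :* w) refl n L (sq W) ⟩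
  9408 * n * sq L * sq W                 ≤⟨ *-monoˡ-≤ (sq W) (*-monoˡ-≤ (sq L) (*-monoˡ-≤ n (≤ᵇ⇒≤ 9408 (97 * 97) tt))) ⟩
  97 * 97 * n * sq L * sq W              ∎
  where
  open ≤-Reasoning
  open ℕ-Solver.+-*-Solver
  open Expectation s′
  open Bounds s′ using (A)
  open Potential s′ using (s)
  n = suc m
  W = Ω n T
  L = ⌊log₂ n ⌋
  a = L + L + 11
  a+1≤14L : a + 1 ≤ 14 * L
  a+1≤14L = begin
    L + L + 11 + 1      ≡⟨ solve 1 (λ l → l :+ l :+ con 11 :+ con 1 := con 2 :* l :+ con 12) refl L ⟩
    2 * L + 12          ≤⟨ +-monoʳ-≤ (2 * L) (*-monoʳ-≤ 12 1≤L) ⟩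
    2 * L + 12 * L      ≡⟨ solve 1 (λ l → con 2 :* l :+ con 12 :* l := con 14 :* l) refl L ⟩
    14 * L              ∎
  n≤2^L*2 : n ≤ 2 ^ L * 2
  n≤2^L*2 = ≤-trans (<⇒≤ (<2^[1+⌊log₂⌋] n)) (≤-reflexive (*-comm 2 (2 ^ L)))
  2nA≤2^a : 2 * (n * A) ≤ 2 ^ a
  2nA≤2^a = begin
    2 * (n * (2 * s + 2))            ≤⟨ *-monoʳ-≤ 2 (*-monoʳ-≤ n (+-monoʳ-≤ (2 * s) (*-monoʳ-≤ 2 (s≤s (z≤n {s′}))))) ⟩
    2 * (n * (2 * s + 2 * s))        ≡⟨ solve 2 (λ n s → con 2 :* (n :* (con 2 :* s :+ con 2 :* s)) := con 8 :* (n :* s)) refl n s ⟩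
    8 * (n * s)                      ≤⟨ *-monoʳ-≤ 8 (*-monoʳ-≤ n (≤-trans (m≤m*n s s) s²≤48n)) ⟩
    8 * (n * (48 * n))               ≡⟨ solve 1 (λ n → con 8 :* (n :* (con 48 :* n)) := con 384 :* (n :* n)) refl n ⟩
    384 * (n * n)                    ≤⟨ *-monoʳ-≤ 384 (*-mono-≤ n≤2^L*2 n≤2^L*2) ⟩
    384 * ((2 ^ L * 2) * (2 ^ L * 2)) ≡⟨ solve 1 (λ x → con 384 :* ((x :* con 2) :* (x :* con 2)) := con 1536 :* (x :* x)) refl (2 ^ L) ⟩
    1536 * (2 ^ L * 2 ^ L)           ≤⟨ *-monoˡ-≤ (2 ^ L * 2 ^ L) (≤ᵇ⇒≤ 1536 2048 tt) ⟩
    2048 * (2 ^ L * 2 ^ L)           ≡⟨ *-comm 2048 (2 ^ L * 2 ^ L) ⟩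
    (2 ^ L * 2 ^ L) * 2 ^ 11         ≡⟨ cong (_* 2 ^ 11) (^-distribˡ-+-* 2 L L) ⟨
    2 ^ (L + L) * 2 ^ 11             ≡⟨ ^-distribˡ-+-* 2 (L + L) 11 ⟨
    2 ^ a                            ∎

sumV-bound : ∀ n T → 2 ≤ n → sq (sumV n T) ≤ 97 * 97 * n * sq ⌊log₂ n ⌋ * sq (Ω n T)
sumV-bound (suc m) T 2≤n = let s′ , 8n+4≤s² , s²≤48n = scale-exists m in sumV-at-scale s′ m T 8n+4≤s² s²≤48n (1≤⌊log₂⌋ (suc m) 2≤n)

theorem2 : (Σ[ C ∈ ℕ ] Σ[ N₀ ∈ ℕ ] ∀ n T → N₀ ≤ n →
    sumV n T * sumV n T ≤ C * C * n * (⌊log₂ n ⌋ * ⌊log₂ n ⌋) * (Ω n T * Ω n T))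
    ×
    (Σ[ p ∈ ℕ ] Σ[ q ∈ ℕ ] Σ[ C ∈ ℕ ] (p < q) ×
    (∀ n T k → 1 ≤ k →
    countBig n T k * q ^ k ≤ C * n * p ^ k * Ω n T))
theorem2 = (97 , 2 , sumV-bound) , (20 , 21 , 19 , ≤-refl , λ n T k _ → countBig-tail n T k)
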